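{- For every $n\ge1$, $$\Delta\big(\zeta^{(r)}_n\big)=\begin{cases}1\otimes\zeta^{(r)}_n+\zeta^{(r)}_n\otimes1, & \text{if } r\nmid n,\\ \sum_{i=0}^{n/r}\zeta^{(r)}_{ir}\otimes\zeta^{(r)}_{n-ir}, & \text{if } r\mid n.\end{cases}$$
   Context: Work over $\mathbb{C}$; $r\ge1$ is an integer. ${\bf Sym}$ is the free associative algebra on $S_1,S_2,\dots$ ($\deg S_n=n$, $S_0:=1$), a Hopf algebra with coproduct the algebra morphism $\Delta S_n=\sum_{i=0}^nS_i\otimes S_{n-i}$; $\sigma_1:=\sum_nS_n$. The Zassenhaus elements of level $r$, $\zeta^{(r)}_n\in{\bf Sym}_n$ ($n\ge0$, $\zeta^{(r)}_0=1$), are the unique solution of $$\sigma_1=\Big(\sum_{p\ge0}\zeta^{(r)}_{pr}\Big)\prod^{\leftarrow}_{i\ge1,\ r\nmid i}e^{\zeta^{(r)}_i},$$ where the ordered product has factors with decreasing $i$ from left to right ($\cdots e^{\zeta^{(r)}_2}e^{\zeta^{(r)}_1}$, omitting indices divisible by $r$). -}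

module Defs where

open import Data.Nat as ℕ using (ℕ; zero; suc; _∸_; _≤ᵇ_; _!)
open import Data.Nat.Properties using (_!≢0)
open import Data.Nat.Divisibility using (_∣?_)
open import Data.Integer as ℤ using ()
open import Data.Rational using (ℚ; 1ℚ; _+_; _*_; -_; _/_; 0ℚ)
open import Data.List using (List; []; _∷_; [_]; _++_; map; concat; concatMap; foldr; upTo)
import Data.List.Properties as LP
import Data.Product.Properties as PP
open import Data.Product using (_×_; _,_)
open import Data.Bool using (Bool; if_then_else_)
open import Relation.Nullary.Decidable using (does)
open import Relation.Binary.PropositionalEquality using (_≡_)

-- Noncommutative symmetric functions over ℚ (all coefficients involved are rational).
-- A basis element of Sym is a word S_{a1} ... S_{ak} (a composition, entries ≥ 1);
-- the empty word is S_0 = 1.  An element is a formal finite ℚ-linear combination.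
Word : Set
Word = List ℕ

Sym : Set
Sym = List (ℚ × Word)

Sym⊗ : Set
Sym⊗ = List (ℚ × (Word × Word))

wrd : ℕ → Word
wrd zero    = []
wrd (suc k) = [ suc k ]

S : ℕ → Sym
S n = [ (1ℚ , wrd n) ]

one : Sym
one = S 0

infixl 6 _⊕_
_⊕_ : Sym → Sym → Sym
_⊕_ = _++_

scale : ℚ → Sym → Sym
scale c = map (λ { (d , w) → (c * d , w) })

neg : Sym → Sym
neg = scale (- 1ℚ)

infixl 7 _⊛_
_⊛_ : Sym → Sym → Sym
x ⊛ y = concatMap (λ { (c , u) → map (λ { (d , v) → (c * d , u ++ v) }) y }) x

pow : Sym → ℕ → Sym
pow x zero    = one
pow x (suc k) = x ⊛ pow x k

coeff : Sym → Word → ℚ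
coeff x w = foldr (λ { (c , u) acc → if does (LP.≡-dec ℕ._≟_ w u) then c + acc else acc }) 0ℚ x

infix 4 _≈_
_≈_ : Sym → Sym → Set
x ≈ y = ∀ w → coeff x w ≡ coeff y w

infixl 6 _⊕⊗_
_⊕⊗_ : Sym⊗ → Sym⊗ → Sym⊗
_⊕⊗_ = _++_

infixl 7 _⊗_
_⊗_ : Sym → Sym → Sym⊗
x ⊗ y = concatMap (λ { (c , u) → map (λ { (d , v) → (c * d , (u , v)) }) y }) x

scale⊗ : ℚ → Sym⊗ → Sym⊗
scale⊗ c = map (λ { (d , w) → (c * d , w) })

_⊛⊗_ : Sym⊗ → Sym⊗ → Sym⊗
x ⊛⊗ y = concatMap (λ { (c , (u , u')) → map (λ { (d , (v , v')) → (c * d , (u ++ v , u' ++ v')) }) y }) x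

coeff⊗ : Sym⊗ → Word × Word → ℚ
coeff⊗ x w = foldr (λ { (c , u) acc → if does (PP.≡-dec (LP.≡-dec ℕ._≟_) (LP.≡-dec ℕ._≟_) w u) then c + acc else acc }) 0ℚ x

infix 4 _≈⊗_
_≈⊗_ : Sym⊗ → Sym⊗ → Set
x ≈⊗ y = ∀ w → coeff⊗ x w ≡ coeff⊗ y w

ΔS : ℕ → Sym⊗
ΔS n = map (λ i → (1ℚ , (wrd i , wrd (n ∸ i)))) (upTo (suc n))

Δword : Word → Sym⊗
Δword []      = [ (1ℚ , ([] , [])) ]
Δword (a ∷ w) = ΔS a ⊛⊗ Δword w

Δ : Sym → Sym⊗
Δ x = concatMap (λ { (c , w) → scale⊗ c (Δword w) }) x

invFact : ℕ → ℚ
invFact k = (ℤ.+ 1 / (k !)) {{k !≢0}}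

-- Degree-m part of the ordered product  e^{z_i} ⋯ e^{z_2} e^{z_1}
-- (factors with r ∣ j omitted), assuming each z j is homogeneous of degree j.
prodExp : (r : ℕ) → (ℕ → Sym) → (m i : ℕ) → Sym
prodExp r z m zero = if m ≤ᵇ 0 then one else []
prodExp r z m (suc i) =
  if does (r ∣? suc i) then prodExp r z m i
  else concat (map (λ k → if k ℕ.* suc i ≤ᵇ m
                            then scale (invFact k) (pow (z (suc i)) k ⊛ prodExp r z (m ∸ k ℕ.* suc i) i)
                            else [])
                   (upTo (suc m)))

-- Degree-n part of (Σ_p z_{pr}) ∏^← e^{z_i}
rhsDeg : (r : ℕ) → (ℕ → Sym) → ℕ → Sym
rhsDeg r z n = concat (map (λ p → if p ℕ.* r ≤ᵇ n then z (p ℕ.* r) ⊛ prodExp r z (n ∸ p ℕ.* r) n else [])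
                          (upTo (suc n)))

lookupD : List Sym → ℕ → Sym
lookupD []       j       = []
lookupD (x ∷ xs) zero    = x
lookupD (x ∷ xs) (suc j) = lookupD xs j

-- zetaList r n = [ζ_0, …, ζ_n], computed degree by degree: the degree-n part of
-- σ_1 = (Σ_p ζ_{pr}) ∏^← e^{ζ_i} reads S_n = ζ_n + (terms in ζ_0,…,ζ_{n-1}); the latter
-- is rhsDeg evaluated with ζ_n := 0 (lookupD returns 0 beyond the list).
zetaList : (r : ℕ) → ℕ → List Sym
zetaList r zero    = [ one ]
zetaList r (suc n) = zetaList r n ++ [ S (suc n) ⊕ neg (rhsDeg r (lookupD (zetaList r n)) (suc n)) ]

ζ : ℕ → ℕ → Sym
ζ r n = lookupD (zetaList r n) n

-- Elements of Sym and of Sym ⊗ Sym are finite lists of terms.  They are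
-- compared up to ≃ ("no linear functional separates them"), which implies
-- the coefficientwise equality ≈⊗ of the statement.  Write RD(z)_n for the
-- degree-n part of (Σ_p z_{pr}) ∏^← e^{z_i}; the definition of ζ says
-- S_n = RD(ζ)_n.  Let Δ̂_j be the coproduct predicted for ζ_j (primitive if
-- r ∤ j, Σ_i ζ_{ir} ⊗ ζ_{j-ir} if r ∣ j).  The proof is by strong induction:
--   (1) Δ is an algebra morphism, so Δ S_n = RD(Δζ)_n   (CoproductMorphism);
--   (2) a product of exponentials of primitive elements is group-like (binomial
--       theorem and a reindexing of triple sums), hence
--       Δ S_n = Σ_b S_b ⊗ S_{n-b} = Σ_b RD(ζ)_b ⊗ RD(ζ)_{n-b} = RD(Δ̂)_n  (GroupLike);
--   (3) RD(z)_n = (terms in z_0, …, z_{n-1}) + z_n  (extraction), so comparing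
--       RD(Δζ)_n = RD(Δ̂)_n gives Δζ_n = Δ̂_n once Δζ_j = Δ̂_j for j < n.
module Submission where

module FiniteSums where

  open import Data.Nat as ℕ using (ℕ; zero; suc; _≤_; _<_; z≤n; s≤s; _∸_; _≤ᵇ_)
  import Data.Nat.Properties as NP
  open import Data.Rational using (ℚ; 0ℚ; 1ℚ; _+_; _*_)
  import Data.Rational.Properties as QP
  open import Data.Rational.Solver using (module +-*-Solver)
  open +-*-Solver using (solve; _:+_; _:=_)
  open import Data.Bool using (Bool; true; false)
  open import Data.Unit using (tt)
  open import Data.Empty using (⊥-elim)
  open import Relation.Binary.PropositionalEquality
  open import Relation.Nullary using (¬_; does; yes; no; Dec)

  Ind : Bool → ℚ
  Ind true  = 1ℚ
  Ind false = 0ℚ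

  IndD : ∀ {P : Set} → Dec P → ℚ
  IndD d = Ind (does d)

  Ind≤-yes : ∀ {a b} → a ≤ b → Ind (a ≤ᵇ b) ≡ 1ℚ
  Ind≤-yes {a} {b} p with a ≤ᵇ b | NP.≤⇒≤ᵇ p
  ... | true | _ = refl

  Ind≤-no : ∀ {a b} → ¬ a ≤ b → Ind (a ≤ᵇ b) ≡ 0ℚ
  Ind≤-no {a} {b} np with a ≤ᵇ b | NP.≤ᵇ⇒≤ a b
  ... | true  | f = ⊥-elim (np (f tt))
  ... | false | _ = refl

  Ind≤-equiv : ∀ {a b c d} → (a ≤ b → c ≤ d) → (c ≤ d → a ≤ b) → Ind (a ≤ᵇ b) ≡ Ind (c ≤ᵇ d)
  Ind≤-equiv {a} {b} f g with a ℕ.≤? b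
  ... | yes p = trans (Ind≤-yes p) (sym (Ind≤-yes (f p)))
  ... | no np = trans (Ind≤-no np) (sym (Ind≤-no (λ q → np (g q))))

  IndD-yes : ∀ {P : Set} (d : Dec P) → P → IndD d ≡ 1ℚ
  IndD-yes (yes _) p  = refl
  IndD-yes (no np) p  = ⊥-elim (np p)

  IndD-no : ∀ {P : Set} (d : Dec P) → ¬ P → IndD d ≡ 0ℚ
  IndD-no (yes p) np = ⊥-elim (np p)
  IndD-no (no _) np  = refl

  IndD-equiv : ∀ {P Q : Set} (d : Dec P) (e : Dec Q) → (P → Q) → (Q → P) → IndD d ≡ IndD e
  IndD-equiv (yes p) (yes q) f g = refl
  IndD-equiv (yes p) (no nq) f g = ⊥-elim (nq (f p))
  IndD-equiv (no np) (yes q) f g = ⊥-elim (np (g q))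
  IndD-equiv (no np) (no nq) f g = refl

  ≡0⇒*≡0 : ∀ {a} x → a ≡ 0ℚ → a * x ≡ 0ℚ
  ≡0⇒*≡0 x refl = QP.*-zeroˡ x

  ≡1⇒*≡id : ∀ {a} x → a ≡ 1ℚ → a * x ≡ x
  ≡1⇒*≡id x refl = QP.*-identityˡ x

  -- ΣQ N f = f 0 + … + f (N - 1).  It is opaque so that goals are only
  -- rewritten through the lemmas below.
  opaque
    ΣQ : ℕ → (ℕ → ℚ) → ℚ
    ΣQ zero    f = 0ℚ
    ΣQ (suc n) f = f 0 + ΣQ n (λ k → f (suc k))

  opaque
    unfolding ΣQ

    ΣQ-zero : ∀ f → ΣQ zero f ≡ 0ℚ
    ΣQ-zero f = refl

    ΣQ-suc : ∀ n f → ΣQ (suc n) f ≡ f 0 + ΣQ n (λ k → f (suc k))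
    ΣQ-suc n f = refl

    ΣQ-last : ∀ N (f : ℕ → ℚ) → ΣQ (suc N) f ≡ ΣQ N f + f N
    ΣQ-last zero    f = trans (QP.+-identityʳ (f 0)) (sym (QP.+-identityˡ (f 0)))
    ΣQ-last (suc N) f =
      trans (cong (f 0 +_) (ΣQ-last N (λ k → f (suc k)))) (sym (QP.+-assoc (f 0) _ (f (suc N))))

    ΣQ-cong : ∀ N {f g : ℕ → ℚ} → (∀ k → k < N → f k ≡ g k) → ΣQ N f ≡ ΣQ N g
    ΣQ-cong zero    h = refl
    ΣQ-cong (suc N) h = cong₂ _+_ (h 0 (s≤s z≤n)) (ΣQ-cong N (λ k k<N → h (suc k) (s≤s k<N)))

    ΣQ-vanish : ∀ N {f} → (∀ k → k < N → f k ≡ 0ℚ) → ΣQ N f ≡ 0ℚ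
    ΣQ-vanish zero    h = refl
    ΣQ-vanish (suc N) h =
      trans (cong₂ _+_ (h 0 (s≤s z≤n)) (ΣQ-vanish N (λ k k<N → h (suc k) (s≤s k<N)))) (QP.+-identityˡ 0ℚ)

    ΣQ-+ : ∀ N (f g : ℕ → ℚ) → ΣQ N (λ k → f k + g k) ≡ ΣQ N f + ΣQ N g
    ΣQ-+ zero f g = sym (QP.+-identityˡ 0ℚ)
    ΣQ-+ (suc N) f g rewrite ΣQ-+ N (λ k → f (suc k)) (λ k → g (suc k)) =
      solve 4 (λ a b c d → (a :+ b) :+ (c :+ d) := (a :+ c) :+ (b :+ d)) refl
        (f 0) (g 0) (ΣQ N (λ k → f (suc k))) (ΣQ N (λ k → g (suc k)))

    ΣQ-*ˡ : ∀ N c (f : ℕ → ℚ) → ΣQ N (λ k → c * f k) ≡ c * ΣQ N f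
    ΣQ-*ˡ zero    c f = sym (QP.*-zeroʳ c)
    ΣQ-*ˡ (suc N) c f rewrite ΣQ-*ˡ N c (λ k → f (suc k)) = sym (QP.*-distribˡ-+ c (f 0) _)

    ΣQ-swap : ∀ N M (f : ℕ → ℕ → ℚ) →
              ΣQ N (λ i → ΣQ M (λ j → f i j)) ≡ ΣQ M (λ j → ΣQ N (λ i → f i j))
    ΣQ-swap zero    M f = sym (ΣQ-vanish M (λ _ _ → refl))
    ΣQ-swap (suc N) M f rewrite ΣQ-swap N M (λ i j → f (suc i) j) =
      sym (ΣQ-+ M (λ j → f 0 j) (λ j → ΣQ N (λ i → f (suc i) j)))

    ΣQ-trunc : ∀ N M (f : ℕ → ℚ) → N ≤ M → (∀ k → N ≤ k → k < M → f k ≡ 0ℚ) → ΣQ M f ≡ ΣQ N f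
    ΣQ-trunc zero    M       f _          h = ΣQ-vanish M (λ k k<M → h k z≤n k<M)
    ΣQ-trunc (suc N) (suc M) f (s≤s N≤M) h =
      cong (f 0 +_) (ΣQ-trunc N M (λ k → f (suc k)) N≤M (λ k p q → h (suc k) (s≤s p) (s≤s q)))

    ΣQ-collapse : ∀ N t (h : ℕ → ℚ) → t < N → ΣQ N (λ y → IndD (y ℕ.≟ t) * h y) ≡ h t
    ΣQ-collapse (suc N) zero h _ =
      trans (cong₂ _+_ (QP.*-identityˡ (h 0))
                       (ΣQ-vanish N (λ k _ → ≡0⇒*≡0 (h (suc k)) (IndD-no (suc k ℕ.≟ 0) (λ ())))))
            (QP.+-identityʳ (h 0))
    ΣQ-collapse (suc N) (suc t) h (s≤s t<N) =
      trans (cong₂ _+_ (≡0⇒*≡0 (h 0) (IndD-no (0 ℕ.≟ suc t) (λ ())))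
                       (trans (ΣQ-cong N (λ k _ → cong (_* h (suc k)) (shift k)))
                              (ΣQ-collapse N t (λ k → h (suc k)) t<N)))
            (QP.+-identityˡ (h (suc t)))
      where
      shift : ∀ k → IndD (suc k ℕ.≟ suc t) ≡ IndD (k ℕ.≟ t)
      shift k = IndD-equiv (suc k ℕ.≟ suc t) (k ℕ.≟ t) NP.suc-injective (cong suc)

    ΣQ-collapse-out : ∀ N t (h : ℕ → ℚ) → ¬ t < N → ΣQ N (λ y → IndD (y ℕ.≟ t) * h y) ≡ 0ℚ
    ΣQ-collapse-out N t h t≮N =
      ΣQ-vanish N (λ k k<N → ≡0⇒*≡0 (h k) (IndD-no (k ℕ.≟ t) (λ e → t≮N (subst (_< N) e k<N))))

    ΣQ-shift : ∀ N c (f : ℕ → ℚ) → ΣQ N (λ a → Ind (c ≤ᵇ a) * f a) ≡ ΣQ (N ∸ c) (λ b → f (c ℕ.+ b))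
    ΣQ-shift N zero f = ΣQ-cong N (λ k _ → ≡1⇒*≡id (f k) (Ind≤-yes {0} {k} z≤n))
    ΣQ-shift zero (suc c) f = refl
    ΣQ-shift (suc N) (suc c) f =
      trans (cong₂ _+_ (≡0⇒*≡0 (f 0) (Ind≤-no {suc c} {0} (λ ())))
                       (trans (ΣQ-cong N (λ k _ → cong (_* f (suc k)) (shift k)))
                              (ΣQ-shift N c (λ k → f (suc k)))))
            (QP.+-identityˡ _)
      where
      shift : ∀ k → Ind (suc c ≤ᵇ suc k) ≡ Ind (c ≤ᵇ k)
      shift k with c ℕ.≤? k
      ... | yes p = trans (Ind≤-yes (s≤s p)) (sym (Ind≤-yes p))
      ... | no np = trans (Ind≤-no (λ q → np (NP.≤-pred q))) (sym (Ind≤-no np))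

  ΣQ-antidiagonal : ∀ M k → k ≤ M → (X : ℕ → ℕ → ℚ) →
    ΣQ (suc k) (λ j → X j (k ∸ j)) ≡ ΣQ (suc M) (λ j → ΣQ (suc M) (λ l → IndD (j ℕ.+ l ℕ.≟ k) * X j l))
  ΣQ-antidiagonal M k k≤M X = sym (begin
      ΣQ (suc M) (λ j → ΣQ (suc M) (λ l → IndD (j ℕ.+ l ℕ.≟ k) * X j l))
    ≡⟨ ΣQ-cong (suc M) (λ j _ → inner j) ⟩
      ΣQ (suc M) (λ j → Ind (j ≤ᵇ k) * X j (k ∸ j))
    ≡⟨ ΣQ-trunc (suc k) (suc M) _ (s≤s k≤M) (λ j k<j _ → ≡0⇒*≡0 (X j (k ∸ j)) (Ind≤-no (NP.<⇒≱ k<j))) ⟩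
      ΣQ (suc k) (λ j → Ind (j ≤ᵇ k) * X j (k ∸ j))
    ≡⟨ ΣQ-cong (suc k) (λ j j≤k → ≡1⇒*≡id (X j (k ∸ j)) (Ind≤-yes (NP.≤-pred j≤k))) ⟩
      ΣQ (suc k) (λ j → X j (k ∸ j)) ∎)
    where
    open ≡-Reasoning
    inner : ∀ j → ΣQ (suc M) (λ l → IndD (j ℕ.+ l ℕ.≟ k) * X j l) ≡ Ind (j ≤ᵇ k) * X j (k ∸ j)
    inner j with j ℕ.≤? k
    ... | yes j≤k = begin
        ΣQ (suc M) (λ l → IndD (j ℕ.+ l ℕ.≟ k) * X j l)
      ≡⟨ ΣQ-cong (suc M) (λ l _ → cong (_* X j l) (IndD-equiv (j ℕ.+ l ℕ.≟ k) (l ℕ.≟ k ∸ j)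
            (λ e → trans (sym (NP.m+n∸m≡n j l)) (cong (_∸ j) e))
            (λ e → trans (cong (j ℕ.+_) e) (NP.m+[n∸m]≡n j≤k)))) ⟩
        ΣQ (suc M) (λ l → IndD (l ℕ.≟ k ∸ j) * X j l)
      ≡⟨ ΣQ-collapse (suc M) (k ∸ j) (X j) (s≤s (NP.≤-trans (NP.m∸n≤m k j) k≤M)) ⟩
        X j (k ∸ j)
      ≡⟨ sym (≡1⇒*≡id (X j (k ∸ j)) (Ind≤-yes j≤k)) ⟩
        Ind (j ≤ᵇ k) * X j (k ∸ j) ∎
    ... | no j≰k =
      trans (ΣQ-vanish (suc M) (λ l _ → ≡0⇒*≡0 (X j l)
              (IndD-no (j ℕ.+ l ℕ.≟ k) (λ e → j≰k (subst (j ≤_) e (NP.m≤m+n j l))))))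
            (sym (≡0⇒*≡0 (X j (k ∸ j)) (Ind≤-no j≰k)))

module SumReindexing where

  open import Data.Nat as ℕ using (ℕ; suc; _≤_; _<_; z≤n; s≤s; _∸_; _≤ᵇ_; NonZero)
  import Data.Nat.Properties as NP
  import Data.Nat.Solver as ℕSolver
  open import Data.Rational using (ℚ; 0ℚ; _*_)
  open import Data.Rational.Solver using (module +-*-Solver)
  open +-*-Solver using (solve; _:*_; _:=_)
  open import Data.Empty using (⊥-elim)
  open import Relation.Binary.PropositionalEquality
  open import Relation.Nullary using (¬_; yes; no; Dec)
  open FiniteSums

  <suc∸⇒+≤ : ∀ a b m → b < suc m ∸ a → a ℕ.+ b ≤ m
  <suc∸⇒+≤ a b m b< with a ℕ.≤? m
  ... | yes a≤m = subst (_≤ m) (NP.+-comm b a)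
                    (NP.m≤o∸n⇒m+n≤o b a≤m (NP.≤-pred (subst (b <_) (NP.+-∸-assoc 1 a≤m) b<)))
  ... | no a≰m  = ⊥-elim (NP.<⇒≱ b< (subst (_≤ b) (sym (NP.m≤n⇒m∸n≡0 (NP.≰⇒> a≰m))) z≤n))

  -- The combinatorial heart of both "group-like" computations: a triple sum over
  -- (k, j, b) with weights T j (k - j) b (m - ks - b) equals a sum over a split
  -- point a of two independent double sums.  Both sides are shown equal to the
  -- canonical form Canon, a sum over independent indices (j, l).
  module Reindexing (s : ℕ) .{{_ : NonZero s}} (m : ℕ) (T : ℕ → ℕ → ℕ → ℕ → ℚ) where
    open ≡-Reasoning
    module NS = ℕSolver.+-*-Solver

    V : ℕ → ℕ → ℕ → ℚ
    V k j l = ΣQ (suc (m ∸ k ℕ.* s)) (λ b → T j l b (m ∸ k ℕ.* s ∸ b))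

    Canon : ℚ
    Canon = ΣQ (suc m) (λ j → ΣQ (suc m) (λ l → Ind ((j ℕ.+ l) ℕ.* s ≤ᵇ m) * V (j ℕ.+ l) j l))

    LHS : ℚ
    LHS = ΣQ (suc m) (λ k → Ind (k ℕ.* s ≤ᵇ m) *
            ΣQ (suc k) (λ j → ΣQ (suc (m ∸ k ℕ.* s)) (λ b → T j (k ∸ j) b (m ∸ k ℕ.* s ∸ b))))

    RHS : ℚ
    RHS = ΣQ (suc m) (λ a → ΣQ (suc a) (λ j → Ind (j ℕ.* s ≤ᵇ a) *
            ΣQ (suc (m ∸ a)) (λ l → Ind (l ℕ.* s ≤ᵇ m ∸ a) * T j l (a ∸ j ℕ.* s) (m ∸ a ∸ l ℕ.* s))))

    -- Left side: write the sum over j ≤ k as an antidiagonal and sum k out.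
    LHS≡Canon : LHS ≡ Canon
    LHS≡Canon = begin
        LHS
      ≡⟨ ΣQ-cong (suc m) (λ k k≤m → cong (Ind (k ℕ.* s ≤ᵇ m) *_)
           (ΣQ-antidiagonal m k (NP.≤-pred k≤m) (V k))) ⟩
        ΣQ (suc m) (λ k → Ind (k ℕ.* s ≤ᵇ m) * ΣQ (suc m) (λ j → ΣQ (suc m) (λ l → D k j l * V k j l)))
      ≡⟨ ΣQ-cong (suc m) (λ k _ → trans (sym (ΣQ-*ˡ (suc m) (Ind (k ℕ.* s ≤ᵇ m)) _))
           (ΣQ-cong (suc m) (λ j _ → sym (ΣQ-*ˡ (suc m) (Ind (k ℕ.* s ≤ᵇ m)) _)))) ⟩
        ΣQ (suc m) (λ k → ΣQ (suc m) (λ j → ΣQ (suc m) (λ l → W k j l)))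
      ≡⟨ ΣQ-swap (suc m) (suc m) _ ⟩
        ΣQ (suc m) (λ j → ΣQ (suc m) (λ k → ΣQ (suc m) (λ l → W k j l)))
      ≡⟨ ΣQ-cong (suc m) (λ j _ → ΣQ-swap (suc m) (suc m) _) ⟩
        ΣQ (suc m) (λ j → ΣQ (suc m) (λ l → ΣQ (suc m) (λ k → W k j l)))
      ≡⟨ ΣQ-cong (suc m) (λ j _ → ΣQ-cong (suc m) (λ l _ → sum-out-k j l)) ⟩
        Canon ∎
      where
      D : ℕ → ℕ → ℕ → ℚ
      D k j l = IndD (j ℕ.+ l ℕ.≟ k)
      W : ℕ → ℕ → ℕ → ℚ
      W k j l = Ind (k ℕ.* s ≤ᵇ m) * (D k j l * V k j l)

      sum-out-k : ∀ j l → ΣQ (suc m) (λ k → W k j l) ≡ Ind ((j ℕ.+ l) ℕ.* s ≤ᵇ m) * V (j ℕ.+ l) j l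
      sum-out-k j l = trans (ΣQ-cong (suc m) (λ k _ → delta-first k)) (collapse (j ℕ.+ l ℕ.<? suc m))
        where
        delta-first : ∀ k → W k j l ≡ IndD (k ℕ.≟ j ℕ.+ l) * (Ind (k ℕ.* s ≤ᵇ m) * V k j l)
        delta-first k =
          trans (solve 3 (λ a b c → a :* (b :* c) := b :* (a :* c)) refl (Ind (k ℕ.* s ≤ᵇ m)) (D k j l) (V k j l))
                (cong (_* (Ind (k ℕ.* s ≤ᵇ m) * V k j l)) (IndD-equiv (j ℕ.+ l ℕ.≟ k) (k ℕ.≟ j ℕ.+ l) sym sym))
        collapse : Dec (j ℕ.+ l < suc m) → ΣQ (suc m) (λ k → IndD (k ℕ.≟ j ℕ.+ l) * (Ind (k ℕ.* s ≤ᵇ m) * V k j l))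
                       ≡ Ind ((j ℕ.+ l) ℕ.* s ≤ᵇ m) * V (j ℕ.+ l) j l
        collapse (yes j+l≤m) = ΣQ-collapse (suc m) (j ℕ.+ l) (λ k → Ind (k ℕ.* s ≤ᵇ m) * V k j l) j+l≤m
        collapse (no j+l≰m)  = trans (ΣQ-collapse-out (suc m) (j ℕ.+ l) _ j+l≰m)
          (sym (≡0⇒*≡0 (V (j ℕ.+ l) j l)
            (Ind≤-no (λ q → j+l≰m (s≤s (NP.≤-trans (NP.m≤m*n (j ℕ.+ l) s) q))))))

    H : ℕ → ℕ → ℕ → ℚ
    H a j l = Ind (l ℕ.* s ≤ᵇ m ∸ a) * T j l (a ∸ j ℕ.* s) (m ∸ a ∸ l ℕ.* s)

    U : ℕ → ℕ → ℕ → ℚ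
    U a j l = Ind (j ℕ.* s ≤ᵇ a) * H a j l

    extend-ranges : ∀ a → a ≤ m →
      ΣQ (suc a) (λ j → Ind (j ℕ.* s ≤ᵇ a) * ΣQ (suc (m ∸ a)) (H a j)) ≡ ΣQ (suc m) (λ j → ΣQ (suc m) (λ l → U a j l))
    extend-ranges a a≤m = begin
        ΣQ (suc a) (λ j → Ind (j ℕ.* s ≤ᵇ a) * ΣQ (suc (m ∸ a)) (H a j))
      ≡⟨ sym (ΣQ-trunc (suc a) (suc m) _ (s≤s a≤m)
           (λ j a<j _ → ≡0⇒*≡0 _ (Ind≤-no (λ q → NP.<⇒≱ a<j (NP.≤-trans (NP.m≤m*n j s) q))))) ⟩
        ΣQ (suc m) (λ j → Ind (j ℕ.* s ≤ᵇ a) * ΣQ (suc (m ∸ a)) (H a j))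
      ≡⟨ ΣQ-cong (suc m) (λ j _ → trans (cong (Ind (j ℕ.* s ≤ᵇ a) *_) (sym (extend-l j)))
                                        (sym (ΣQ-*ˡ (suc m) (Ind (j ℕ.* s ≤ᵇ a)) (H a j)))) ⟩
        ΣQ (suc m) (λ j → ΣQ (suc m) (λ l → U a j l)) ∎
      where
      extend-l : ∀ j → ΣQ (suc m) (H a j) ≡ ΣQ (suc (m ∸ a)) (H a j)
      extend-l j = ΣQ-trunc (suc (m ∸ a)) (suc m) (H a j) (s≤s (NP.m∸n≤m m a))
        (λ l m∸a<l _ → ≡0⇒*≡0 _ (Ind≤-no (λ q → NP.<⇒≱ m∸a<l (NP.≤-trans (NP.m≤m*n l s) q))))

    -- For fixed (j, l) the admissible split points are a = j s + b, and the
    -- constraint on b is b ≤ m - (j + l) s.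
    module SplitPoint (j l : ℕ) where
      js ls c : ℕ
      js = j ℕ.* s
      ls = l ℕ.* s
      c  = (j ℕ.+ l) ℕ.* s

      rearrange : ∀ b → ls ℕ.+ (js ℕ.+ b) ≡ b ℕ.+ c
      rearrange b = trans (NS.solve 3 (λ x y z → z NS.:+ (x NS.:+ y) NS.:= y NS.:+ (x NS.:+ z)) refl js b ls)
                          (cong (b ℕ.+_) (sym (NP.*-distribʳ-+ s j l)))

      remaining : ∀ b → m ∸ (js ℕ.+ b) ∸ ls ≡ m ∸ c ∸ b
      remaining b = begin
        m ∸ (js ℕ.+ b) ∸ ls    ≡⟨ NP.∸-+-assoc m (js ℕ.+ b) ls ⟩
        m ∸ (js ℕ.+ b ℕ.+ ls)  ≡⟨ cong (m ∸_) (trans (NP.+-comm (js ℕ.+ b) ls) (rearrange b)) ⟩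
        m ∸ (b ℕ.+ c)          ≡⟨ cong (m ∸_) (NP.+-comm b c) ⟩
        m ∸ (c ℕ.+ b)          ≡⟨ sym (NP.∸-+-assoc m c b) ⟩
        m ∸ c ∸ b ∎

      fits⇒ : ∀ b → js ℕ.+ b ≤ m → ls ≤ m ∸ (js ℕ.+ b) → b ℕ.+ c ≤ m
      fits⇒ b jsb≤m p = subst (_≤ m) (rearrange b) (NP.m≤o∸n⇒m+n≤o ls jsb≤m p)

      ⇒fits : ∀ b → c ≤ m → b ≤ m ∸ c → ls ≤ m ∸ (js ℕ.+ b)
      ⇒fits b c≤m q = NP.m+n≤o⇒m≤o∸n ls (subst (_≤ m) (sym (rearrange b)) (NP.m≤o∸n⇒m+n≤o b c≤m q))

      fits : c ≤ m → ΣQ (suc m ∸ js) (λ b → H (js ℕ.+ b) j l) ≡ V (j ℕ.+ l) j l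
      fits c≤m = begin
          ΣQ (suc m ∸ js) (λ b → H (js ℕ.+ b) j l)
        ≡⟨ ΣQ-cong (suc m ∸ js) (λ b b< → cong₂ _*_
             (Ind≤-equiv (λ p → NP.m+n≤o⇒m≤o∸n b (fits⇒ b (<suc∸⇒+≤ js b m b<) p)) (⇒fits b c≤m))
             (cong₂ (T j l) (NP.m+n∸m≡n js b) (remaining b))) ⟩
          ΣQ (suc m ∸ js) (λ b → Ind (b ≤ᵇ m ∸ c) * T j l b (m ∸ c ∸ b))
        ≡⟨ ΣQ-trunc (suc (m ∸ c)) (suc m ∸ js) _ range (λ b m∸c<b _ → ≡0⇒*≡0 _ (Ind≤-no (NP.<⇒≱ m∸c<b))) ⟩
          ΣQ (suc (m ∸ c)) (λ b → Ind (b ≤ᵇ m ∸ c) * T j l b (m ∸ c ∸ b))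
        ≡⟨ ΣQ-cong (suc (m ∸ c)) (λ b b≤ → ≡1⇒*≡id _ (Ind≤-yes (NP.≤-pred b≤))) ⟩
          V (j ℕ.+ l) j l ∎
        where
        js≤c : js ≤ c
        js≤c = subst (js ≤_) (sym (NP.*-distribʳ-+ s j l)) (NP.m≤m+n js ls)
        range : suc (m ∸ c) ≤ suc m ∸ js
        range = subst (suc (m ∸ c) ≤_) (sym (NP.+-∸-assoc 1 (NP.≤-trans js≤c c≤m))) (s≤s (NP.∸-monoʳ-≤ m js≤c))

      too-big : ¬ c ≤ m → ΣQ (suc m ∸ js) (λ b → H (js ℕ.+ b) j l) ≡ 0ℚ
      too-big c≰m = ΣQ-vanish (suc m ∸ js) (λ b b< → ≡0⇒*≡0 _ (Ind≤-no (λ p →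
                      c≰m (NP.≤-trans (NP.m≤n+m c b) (fits⇒ b (<suc∸⇒+≤ js b m b<) p)))))

      sum-out-a : ΣQ (suc m) (λ a → U a j l) ≡ Ind (c ≤ᵇ m) * V (j ℕ.+ l) j l
      sum-out-a with c ℕ.≤? m
      ... | yes c≤m = trans (ΣQ-shift (suc m) js (λ a → H a j l)) (trans (fits c≤m) (sym (≡1⇒*≡id _ (Ind≤-yes c≤m))))
      ... | no c≰m  = trans (ΣQ-shift (suc m) js (λ a → H a j l)) (trans (too-big c≰m) (sym (≡0⇒*≡0 _ (Ind≤-no c≰m))))

    -- Right side: extend the inner ranges, move the sum over the split point a
    -- innermost, and evaluate it for each pair (j, l).
    RHS≡Canon : RHS ≡ Canon
    RHS≡Canon = begin
        RHS
      ≡⟨ ΣQ-cong (suc m) (λ a a≤m → extend-ranges a (NP.≤-pred a≤m)) ⟩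
        ΣQ (suc m) (λ a → ΣQ (suc m) (λ j → ΣQ (suc m) (λ l → U a j l)))
      ≡⟨ ΣQ-swap (suc m) (suc m) _ ⟩
        ΣQ (suc m) (λ j → ΣQ (suc m) (λ a → ΣQ (suc m) (λ l → U a j l)))
      ≡⟨ ΣQ-cong (suc m) (λ j _ → ΣQ-swap (suc m) (suc m) _) ⟩
        ΣQ (suc m) (λ j → ΣQ (suc m) (λ l → ΣQ (suc m) (λ a → U a j l)))
      ≡⟨ ΣQ-cong (suc m) (λ j _ → ΣQ-cong (suc m) (λ l _ → SplitPoint.sum-out-a j l)) ⟩
        Canon ∎

    reindex : LHS ≡ RHS
    reindex = trans LHS≡Canon (sym RHS≡Canon)

module LinearCombinations where

  open import Data.Nat as ℕ using (ℕ; zero; suc; _≤_; _<_; z≤n; s≤s; _∸_; _≤ᵇ_; NonZero)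
  import Data.Nat.Properties as NP
  open import Data.Nat.Divisibility using (_∣?_; _∣_; divides)
  open import Data.Rational using (ℚ; 0ℚ; 1ℚ; _+_; _*_)
  import Data.Rational.Properties as QP
  open import Data.Rational.Solver using (module +-*-Solver)
  open +-*-Solver using (solve; _:+_; _:*_; _:=_)
  open import Data.Bool using (true; false; if_then_else_)
  open import Data.List using (List; []; _∷_; _++_; map; concat; concatMap; upTo; applyUpTo; [_])
  open import Data.Product using (_×_; _,_; proj₁; proj₂)
  open import Data.Empty using (⊥-elim)
  open import Relation.Binary.PropositionalEquality hiding ([_])
  open import Relation.Nullary using (¬_; does; yes; no; Dec)
  open import Defs using (invFact)
  open FiniteSums

  ifDec : ∀ {A P : Set} → Dec P → A → A → A
  ifDec (yes _) a b = a
  ifDec (no _)  a b = b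

  ifDec-yes : ∀ {A P : Set} (d : Dec P) (a b : A) → P → ifDec d a b ≡ a
  ifDec-yes (yes _) a b p = refl
  ifDec-yes (no np) a b p = ⊥-elim (np p)

  ifDec-no : ∀ {A P : Set} (d : Dec P) (a b : A) → ¬ P → ifDec d a b ≡ b
  ifDec-no (yes p) a b np = ⊥-elim (np p)
  ifDec-no (no _)  a b np = refl

  LC : Set → Set
  LC B = List (ℚ × B)

  L : ∀ {B : Set} → (B → ℚ) → LC B → ℚ
  L g []            = 0ℚ
  L g ((c , u) ∷ x) = c * g u + L g x

  -- Two combinations are equivalent when no linear functional separates them.
  -- This is the working equality throughout; coefficientwise equality is the
  -- special case g = Kronecker delta.
  infix 4 _≃_
  _≃_ : ∀ {B : Set} → LC B → LC B → Set
  x ≃ y = ∀ g → L g x ≡ L g y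

  module _ {B : Set} where

    L-++ : ∀ g (x y : LC B) → L g (x ++ y) ≡ L g x + L g y
    L-++ g []            y = sym (QP.+-identityˡ _)
    L-++ g ((c , u) ∷ x) y rewrite L-++ g x y = sym (QP.+-assoc (c * g u) (L g x) (L g y))

    L-ext : ∀ {g h : B → ℚ} → (∀ u → g u ≡ h u) → ∀ x → L g x ≡ L h x
    L-ext e []            = refl
    L-ext e ((c , u) ∷ x) = cong₂ (λ a b → c * a + b) (e u) (L-ext e x)

    L-+g : ∀ (g h : B → ℚ) x → L (λ u → g u + h u) x ≡ L g x + L h x
    L-+g g h [] = sym (QP.+-identityˡ 0ℚ)
    L-+g g h ((c , u) ∷ x) rewrite L-+g g h x =
      solve 5 (λ c a b p q → c :* (a :+ b) :+ (p :+ q) := (c :* a :+ p) :+ (c :* b :+ q)) refl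
        c (g u) (h u) (L g x) (L h x)

    L-*g : ∀ a (g : B → ℚ) x → L (λ u → a * g u) x ≡ a * L g x
    L-*g a g [] = sym (QP.*-zeroʳ a)
    L-*g a g ((c , u) ∷ x) rewrite L-*g a g x =
      solve 4 (λ a c b p → c :* (a :* b) :+ a :* p := a :* (c :* b :+ p)) refl a c (g u) (L g x)

    L-0g : ∀ (x : LC B) → L (λ _ → 0ℚ) x ≡ 0ℚ
    L-0g []            = refl
    L-0g ((c , u) ∷ x) rewrite L-0g x = trans (QP.+-identityʳ _) (QP.*-zeroʳ c)

    L-Σ-applyUpTo : ∀ g N (F : ℕ → LC B) (φ : ℕ → ℕ) →
                    L g (concat (map F (applyUpTo φ N))) ≡ ΣQ N (λ k → L g (F (φ k)))
    L-Σ-applyUpTo g zero    F φ = sym (ΣQ-zero _)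
    L-Σ-applyUpTo g (suc N) F φ =
      trans (L-++ g (F (φ 0)) _)
            (trans (cong (L g (F (φ 0)) +_) (L-Σ-applyUpTo g N F (λ k → φ (suc k)))) (sym (ΣQ-suc N _)))

    L-Σ : ∀ g N (F : ℕ → LC B) → L g (concat (map F (upTo N))) ≡ ΣQ N (λ k → L g (F k))
    L-Σ g N F = L-Σ-applyUpTo g N F (λ k → k)

    L-if : ∀ g b (x : LC B) → L g (if b then x else []) ≡ Ind b * L g x
    L-if g true  x = sym (QP.*-identityˡ _)
    L-if g false x = sym (QP.*-zeroˡ (L g x))

    Σ-cong : ∀ N (F G : ℕ → LC B) → (∀ k → k < N → F k ≃ G k) →
             concat (map F (upTo N)) ≃ concat (map G (upTo N))
    Σ-cong N F G e g = trans (L-Σ g N F) (trans (ΣQ-cong N (λ k k< → e k k< g)) (sym (L-Σ g N G)))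

    if-cong : ∀ b {x y : LC B} → x ≃ y → (if b then x else []) ≃ (if b then y else [])
    if-cong true  e   = e
    if-cong false e g = refl

  L-swap : ∀ {B C : Set} (h : B → C → ℚ) (x : LC B) (y : LC C) →
           L (λ u → L (λ v → h u v) y) x ≡ L (λ v → L (λ u → h u v) x) y
  L-swap h [] y = sym (L-0g y)
  L-swap h ((c , u) ∷ x) y rewrite L-swap h x y =
    sym (trans (L-+g (λ v → c * h u v) (λ v → L (λ u₁ → h u₁ v) x) y)
               (cong (_+ L (λ v → L (λ u₁ → h u₁ v) x) y) (L-*g c (h u) y)))

  L-ΣQ : ∀ {B : Set} N (f : ℕ → B → ℚ) (x : LC B) → L (λ u → ΣQ N (λ k → f k u)) x ≡ ΣQ N (λ k → L (f k) x)
  L-ΣQ zero f x = trans (L-ext (λ u → ΣQ-zero _) x) (trans (L-0g x) (sym (ΣQ-zero _)))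
  L-ΣQ (suc N) f x = begin
      L (λ u → ΣQ (suc N) (λ k → f k u)) x           ≡⟨ L-ext (λ u → ΣQ-suc N (λ k → f k u)) x ⟩
      L (λ u → f 0 u + ΣQ N (λ k → f (suc k) u)) x   ≡⟨ L-+g (f 0) _ x ⟩
      L (f 0) x + L (λ u → ΣQ N (λ k → f (suc k) u)) x ≡⟨ cong (L (f 0) x +_) (L-ΣQ N (λ k → f (suc k)) x) ⟩
      L (f 0) x + ΣQ N (λ k → L (f (suc k)) x)       ≡⟨ sym (ΣQ-suc N (λ k → L (f k) x)) ⟩
      ΣQ (suc N) (λ k → L (f k) x) ∎
    where open ≡-Reasoning

  scaleLC : ∀ {B : Set} → ℚ → LC B → LC B
  scaleLC c = map (λ p → (c * proj₁ p , proj₂ p))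

  bilinear : ∀ {B C D : Set} → (B → C → D) → LC B → LC C → LC D
  bilinear h x y = concatMap (λ p → map (λ q → (proj₁ p * proj₁ q , h (proj₂ p) (proj₂ q))) y) x

  L-scaleLC : ∀ {B : Set} g c (x : LC B) → L g (scaleLC c x) ≡ c * L g x
  L-scaleLC g c [] = sym (QP.*-zeroʳ c)
  L-scaleLC g c ((d , w) ∷ y) rewrite L-scaleLC g c y =
    solve 4 (λ c d a b → (c :* d) :* a :+ c :* b := c :* (d :* a :+ b)) refl c d (g w) (L g y)

  L-bilinear : ∀ {B C D : Set} (g : D → ℚ) (h : B → C → D) x y →
               L g (bilinear h x y) ≡ L (λ u → L (λ v → g (h u v)) y) x
  L-bilinear g h []            y = refl
  L-bilinear g h ((c , u) ∷ x) y =
    trans (L-++ g (map _ y) (bilinear h x y))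
          (cong₂ _+_ (row y) (L-bilinear g h x y))
    where
    row : ∀ y → L g (map (λ q → (c * proj₁ q , h u (proj₂ q))) y) ≡ c * L (λ v → g (h u v)) y
    row [] = sym (QP.*-zeroʳ c)
    row ((d , v) ∷ y) rewrite row y =
      solve 4 (λ c d a b → (c :* d) :* a :+ c :* b := c :* (d :* a :+ b)) refl c d (g (h u v)) (L (λ v → g (h u v)) y)

  -- Everything is proved for an arbitrary monoid so
  -- that it applies both to Sym (words) and to Sym ⊗ Sym (pairs of words).
  -- The product mul and the scalar action sc are parameters (rather than defined
  -- as bilinear _∙_ and scaleLC) so that they are instantiated by the concrete
  -- operations of Defs verbatim; L-mul and L-sc say what they are.
  module MonoidAlgebra {B : Set} (_∙_ : B → B → B) (e : B)
    (∙-assoc : ∀ a b c → (a ∙ b) ∙ c ≡ a ∙ (b ∙ c)) (∙-idˡ : ∀ a → e ∙ a ≡ a) (∙-idʳ : ∀ a → a ∙ e ≡ a)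
    (mul : LC B → LC B → LC B) (L-mul : ∀ g x y → L g (mul x y) ≡ L (λ u → L (λ v → g (u ∙ v)) y) x)
    (sc : ℚ → LC B → LC B) (L-sc : ∀ g c x → L g (sc c x) ≡ c * L g x) where

    one : LC B
    one = [ (1ℚ , e) ]

    L-one : ∀ g → L g one ≡ g e
    L-one g = trans (QP.+-identityʳ _) (QP.*-identityˡ _)

    mul-cong : ∀ {x x' y y'} → x ≃ x' → y ≃ y' → mul x y ≃ mul x' y'
    mul-cong {x} {x'} {y} {y'} ex ey g = begin
        L g (mul x y)                      ≡⟨ L-mul g x y ⟩
        L (λ u → L (λ v → g (u ∙ v)) y) x  ≡⟨ L-ext (λ u → ey (λ v → g (u ∙ v))) x ⟩
        L (λ u → L (λ v → g (u ∙ v)) y') x ≡⟨ ex _ ⟩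
        L (λ u → L (λ v → g (u ∙ v)) y') x' ≡⟨ sym (L-mul g x' y') ⟩
        L g (mul x' y') ∎
      where open ≡-Reasoning

    mul-assoc : ∀ x y z → mul (mul x y) z ≃ mul x (mul y z)
    mul-assoc x y z g = begin
        L g (mul (mul x y) z)                                  ≡⟨ L-mul g _ z ⟩
        L (λ s → L (λ t → g (s ∙ t)) z) (mul x y)              ≡⟨ L-mul _ x y ⟩
        L (λ u → L (λ v → L (λ t → g ((u ∙ v) ∙ t)) z) y) x
          ≡⟨ L-ext (λ u → L-ext (λ v → L-ext (λ t → cong g (∙-assoc u v t)) z) y) x ⟩
        L (λ u → L (λ v → L (λ t → g (u ∙ (v ∙ t))) z) y) x    ≡⟨ L-ext (λ u → sym (L-mul (λ s → g (u ∙ s)) y z)) x ⟩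
        L (λ u → L (λ s → g (u ∙ s)) (mul y z)) x              ≡⟨ sym (L-mul g x _) ⟩
        L g (mul x (mul y z)) ∎
      where open ≡-Reasoning

    one-l : ∀ x → mul one x ≃ x
    one-l x g = trans (L-mul g one x) (trans (L-one (λ u → L (λ v → g (u ∙ v)) x)) (L-ext (λ v → cong g (∙-idˡ v)) x))

    one-r : ∀ x → mul x one ≃ x
    one-r x g = trans (L-mul g x one) (L-ext (λ u → trans (L-one (λ v → g (u ∙ v))) (cong g (∙-idʳ u))) x)

    mul-[]ˡ : ∀ x → mul [] x ≃ []
    mul-[]ˡ x g = L-mul g [] x

    sc-cong : ∀ c {x y : LC B} → x ≃ y → sc c x ≃ sc c y
    sc-cong c e g = trans (L-sc g c _) (trans (cong (c *_) (e g)) (sym (L-sc g c _)))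

    mul-sc-l : ∀ c x y → mul (sc c x) y ≃ sc c (mul x y)
    mul-sc-l c x y g =
      trans (L-mul g (sc c x) y)
            (trans (L-sc _ c x) (trans (cong (c *_) (sym (L-mul g x y))) (sym (L-sc g c (mul x y)))))

    mul-sc-r : ∀ c x y → mul x (sc c y) ≃ sc c (mul x y)
    mul-sc-r c x y g =
      trans (L-mul g x (sc c y))
            (trans (L-ext (λ u → L-sc _ c y) x)
                   (trans (L-*g c _ x) (trans (cong (c *_) (sym (L-mul g x y))) (sym (L-sc g c (mul x y))))))

    mul-++ˡ : ∀ x y w → mul (x ++ y) w ≃ (mul x w ++ mul y w)
    mul-++ˡ x y w g =
      trans (L-mul g (x ++ y) w)
            (trans (L-++ _ x y) (trans (cong₂ _+_ (sym (L-mul g x w)) (sym (L-mul g y w))) (sym (L-++ g (mul x w) (mul y w)))))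

    L-mul-++ʳ : ∀ g x y w → L g (mul x (y ++ w)) ≡ L g (mul x y) + L g (mul x w)
    L-mul-++ʳ g x y w = begin
        L g (mul x (y ++ w))                                         ≡⟨ L-mul g x _ ⟩
        L (λ u → L (λ v → g (u ∙ v)) (y ++ w)) x                     ≡⟨ L-ext (λ u → L-++ (λ v → g (u ∙ v)) y w) x ⟩
        L (λ u → L (λ v → g (u ∙ v)) y + L (λ v → g (u ∙ v)) w) x   ≡⟨ L-+g _ _ x ⟩
        L (λ u → L (λ v → g (u ∙ v)) y) x + L (λ u → L (λ v → g (u ∙ v)) w) x
          ≡⟨ sym (cong₂ _+_ (L-mul g x y) (L-mul g x w)) ⟩
        L g (mul x y) + L g (mul x w) ∎
      where open ≡-Reasoning

    L-mul-Σˡ : ∀ g N (F : ℕ → LC B) y → L g (mul (concat (map F (upTo N))) y) ≡ ΣQ N (λ k → L g (mul (F k) y))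
    L-mul-Σˡ g N F y = trans (L-mul g _ y) (trans (L-Σ _ N F) (ΣQ-cong N (λ k _ → sym (L-mul g (F k) y))))

    L-mul-Σʳ : ∀ g N x (F : ℕ → LC B) → L g (mul x (concat (map F (upTo N)))) ≡ ΣQ N (λ k → L g (mul x (F k)))
    L-mul-Σʳ g N x F = begin
        L g (mul x (concat (map F (upTo N))))                  ≡⟨ L-mul g x _ ⟩
        L (λ u → L (λ v → g (u ∙ v)) (concat (map F (upTo N)))) x ≡⟨ L-ext (λ u → L-Σ (λ v → g (u ∙ v)) N F) x ⟩
        L (λ u → ΣQ N (λ k → L (λ v → g (u ∙ v)) (F k))) x     ≡⟨ L-ΣQ N (λ k u → L (λ v → g (u ∙ v)) (F k)) x ⟩
        ΣQ N (λ k → L (λ u → L (λ v → g (u ∙ v)) (F k)) x)     ≡⟨ ΣQ-cong N (λ k _ → sym (L-mul g x (F k))) ⟩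
        ΣQ N (λ k → L g (mul x (F k))) ∎
      where open ≡-Reasoning

    pw : LC B → ℕ → LC B
    pw x zero    = one
    pw x (suc k) = mul x (pw x k)

    pw-cong : ∀ {x y} k → x ≃ y → pw x k ≃ pw y k
    pw-cong zero    e g = refl
    pw-cong (suc k) e   = mul-cong e (pw-cong k e)

    -- PE r z m i: degree-m part of e^{z_i} ⋯ e^{z_1} (factors with r ∣ j
    -- omitted), where z j is taken to be homogeneous of degree j; the factor
    -- e^{z_{i+1}} contributes z_{i+1}^k / k! in degree k (i+1).
    mutual
      PE : ℕ → (ℕ → LC B) → ℕ → ℕ → LC B
      PE r z m zero    = if m ≤ᵇ 0 then one else []
      PE r z m (suc i) = if does (r ∣? suc i) then PE r z m i else PEbody r z m i

      PEterm : ℕ → (ℕ → LC B) → ℕ → ℕ → ℕ → LC B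
      PEterm r z m i k = if k ℕ.* suc i ≤ᵇ m
                           then sc (invFact k) (mul (pw (z (suc i)) k) (PE r z (m ∸ k ℕ.* suc i) i))
                           else []

      PEbody : ℕ → (ℕ → LC B) → ℕ → ℕ → LC B
      PEbody r z m i = concat (map (PEterm r z m i) (upTo (suc m)))

    RDterm : ℕ → (ℕ → LC B) → ℕ → ℕ → LC B
    RDterm r z n p = if p ℕ.* r ≤ᵇ n then mul (z (p ℕ.* r)) (PE r z (n ∸ p ℕ.* r) n) else []

    -- RD r z n: the degree-n part of (Σ_p z_{pr}) · ∏^← e^{z_i}.
    RD : ℕ → (ℕ → LC B) → ℕ → LC B
    RD r z n = concat (map (RDterm r z n) (upTo (suc n)))

    if≤-cong : ∀ a m {X Y : LC B} → (a ≤ m → X ≃ Y) → (if a ≤ᵇ m then X else []) ≃ (if a ≤ᵇ m then Y else [])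
    if≤-cong a m {X} {Y} f g with a ℕ.≤? m
    ... | yes p = trans (L-if g (a ≤ᵇ m) X) (trans (cong (_* L g X) (Ind≤-yes p))
                    (trans (cong (1ℚ *_) (f p g)) (trans (cong (_* L g Y) (sym (Ind≤-yes p))) (sym (L-if g (a ≤ᵇ m) Y)))))
    ... | no p  = trans (L-if g (a ≤ᵇ m) X) (trans (≡0⇒*≡0 (L g X) (Ind≤-no p))
                    (sym (trans (L-if g (a ≤ᵇ m) Y) (≡0⇒*≡0 (L g Y) (Ind≤-no p)))))

    PE-cong : ∀ r {z z'} i m → (∀ j → j ≤ m → j ≤ i → z j ≃ z' j) → PE r z m i ≃ PE r z' m i
    PE-cong r zero m h g = refl
    PE-cong r {z} {z'} (suc i) m h with r ∣? suc i
    ... | yes _ = PE-cong r i m (λ j a b → h j a (NP.m≤n⇒m≤1+n b))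
    ... | no _  = Σ-cong (suc m) (PEterm r z m i) (PEterm r z' m i) (λ k _ →
                    if≤-cong (k ℕ.* suc i) m (λ le → sc-cong (invFact k) (mul-cong (power k le)
                      (PE-cong r i (m ∸ k ℕ.* suc i)
                        (λ j a b → h j (NP.≤-trans a (NP.m∸n≤m m (k ℕ.* suc i))) (NP.m≤n⇒m≤1+n b))))))
      where
      power : ∀ k → k ℕ.* suc i ≤ m → pw (z (suc i)) k ≃ pw (z' (suc i)) k
      power zero    _  g = refl
      power (suc k) le   = pw-cong (suc k) (h (suc i) (NP.≤-trans (NP.m≤m+n (suc i) (k ℕ.* suc i)) le) NP.≤-refl)

    RD-cong : ∀ r {z z'} n → (∀ j → j ≤ n → z j ≃ z' j) → RD r z n ≃ RD r z' n
    RD-cong r {z} {z'} n h = Σ-cong (suc n) (RDterm r z n) (RDterm r z' n) (λ p _ →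
      if≤-cong (p ℕ.* r) n (λ le → mul-cong (h (p ℕ.* r) le)
        (PE-cong r n (n ∸ p ℕ.* r) (λ j a _ → h j (NP.≤-trans a (NP.m∸n≤m n (p ℕ.* r)))))))

    PEterm-0 : ∀ r z m i → PEterm r z m i 0 ≃ PE r z m i
    PEterm-0 r z m i g =
      trans (L-if g (0 ≤ᵇ m) (sc 1ℚ (mul one (PE r z m i)))) (trans (≡1⇒*≡id _ (Ind≤-yes {0} {m} z≤n))
            (trans (L-sc g 1ℚ (mul one (PE r z m i))) (trans (QP.*-identityˡ _) (one-l (PE r z m i) g))))

    PEbody-split : ∀ r z m i g → L g (PEbody r z m i) ≡ L g (PE r z m i) + ΣQ m (λ k → L g (PEterm r z m i (suc k)))
    PEbody-split r z m i g =
      trans (L-Σ g (suc m) (PEterm r z m i))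
            (trans (ΣQ-suc m _) (cong (_+ ΣQ m (λ k → L g (PEterm r z m i (suc k)))) (PEterm-0 r z m i g)))

    PEterm-vanish : ∀ r z m i k g → ¬ k ℕ.* suc i ≤ m → L g (PEterm r z m i k) ≡ 0ℚ
    PEterm-vanish r z m i k g k>m = trans (L-if g (k ℕ.* suc i ≤ᵇ m) _) (≡0⇒*≡0 _ (Ind≤-no k>m))

    PE-0 : ∀ r z i → PE r z 0 i ≃ one
    PE-0 r z zero g = refl
    PE-0 r z (suc i) with r ∣? suc i
    ... | yes _ = PE-0 r z i
    ... | no _  = λ g → trans (PEbody-split r z 0 i g)
                          (trans (cong (L g (PE r z 0 i) +_) (ΣQ-zero _)) (trans (QP.+-identityʳ _) (PE-0 r z i g)))

    PE-stab : ∀ r z i m → m ≤ i → PE r z m (suc i) ≃ PE r z m i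
    PE-stab r z i m m≤i with r ∣? suc i
    ... | yes _ = λ g → refl
    ... | no _  = λ g → trans (PEbody-split r z m i g)
                          (trans (cong (L g (PE r z m i) +_) (ΣQ-vanish m (λ k _ → PEterm-vanish r z m i (suc k) g
                                   (λ le → NP.<⇒≱ (s≤s m≤i) (NP.≤-trans (NP.m≤m+n (suc i) (k ℕ.* suc i)) le)))))
                                 (QP.+-identityʳ _))

    PE-stab* : ∀ r z m i → m ≤ i → PE r z m i ≃ PE r z m m
    PE-stab* r z m i le = go i (NP.≤⇒≤′ le)
      where
      go : ∀ i → m ℕ.≤′ i → PE r z m i ≃ PE r z m m
      go i       ℕ.≤′-refl         g = refl
      go (suc i) (ℕ.≤′-step le') g = trans (PE-stab r z i m (NP.≤′⇒≤ le') g) (go i le' g)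

    RD-0 : ∀ r z → z 0 ≃ one → RD r z 0 ≃ one
    RD-0 r z z0 g = begin
        L g (RD r z 0)                 ≡⟨ L-Σ g 1 (RDterm r z 0) ⟩
        ΣQ 1 (λ p → L g (RDterm r z 0 p)) ≡⟨ trans (ΣQ-suc 0 _) (cong (L g (RDterm r z 0 0) +_) (ΣQ-zero _)) ⟩
        L g (RDterm r z 0 0) + 0ℚ      ≡⟨ QP.+-identityʳ _ ⟩
        L g (mul (z 0) (PE r z 0 0))   ≡⟨ mul-cong z0 (PE-0 r z 0) g ⟩
        L g (mul one one)              ≡⟨ one-l one g ⟩
        L g one ∎
      where open ≡-Reasoning

    kill : ℕ → (ℕ → LC B) → ℕ → LC B
    kill n z j = ifDec (j ℕ.≟ n) [] (z j)

    kill-eq : ∀ n z → kill n z n ≡ []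
    kill-eq n z = ifDec-yes (n ℕ.≟ n) [] (z n) refl

    kill-ne : ∀ n z j → ¬ j ≡ n → z j ≃ kill n z j
    kill-ne n z j j≢n g = cong (L g) (sym (ifDec-no (j ℕ.≟ n) [] (z j) j≢n))

    PE-kill-deg : ∀ r z n m → m < n → ∀ i → PE r z m i ≃ PE r (kill n z) m i
    PE-kill-deg r z n m m<n i = PE-cong r i m (λ j j≤m _ → kill-ne n z j (NP.<⇒≢ (NP.≤-<-trans j≤m m<n)))

    PE-kill-len : ∀ r z n i → i < n → ∀ m → PE r z m i ≃ PE r (kill n z) m i
    PE-kill-len r z n i i<n m = PE-cong r i m (λ j _ j≤i → kill-ne n z j (NP.<⇒≢ (NP.≤-<-trans j≤i i<n)))

    PEterm-top : ∀ r z i → PEterm r z (suc i) i 1 ≃ z (suc i)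
    PEterm-top r z i g = begin
        L g (PEterm r z n i 1)                    ≡⟨ L-if g (1 ℕ.* n ≤ᵇ n) (sc (invFact 1) X) ⟩
        Ind (1 ℕ.* n ≤ᵇ n) * L g (sc (invFact 1) X) ≡⟨ ≡1⇒*≡id _ (Ind≤-yes (NP.≤-reflexive (NP.*-identityˡ n))) ⟩
        L g (sc (invFact 1) X)                    ≡⟨ trans (L-sc g (invFact 1) X) (QP.*-identityˡ _) ⟩
        L g X                                     ≡⟨ mul-cong (one-r (z n)) degree-0 g ⟩
        L g (mul (z n) one)                       ≡⟨ one-r (z n) g ⟩
        L g (z n) ∎
      where
      open ≡-Reasoning
      n : ℕ
      n = suc i
      X : LC B
      X = mul (pw (z n) 1) (PE r z (n ∸ 1 ℕ.* n) i)
      degree-0 : PE r z (n ∸ 1 ℕ.* n) i ≃ one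
      degree-0 = subst (λ a → PE r z a i ≃ one) (sym (trans (cong (n ∸_) (NP.*-identityˡ n)) (NP.n∸n≡0 n))) (PE-0 r z i)

    PEbody-top : ∀ r z i → PEbody r z (suc i) i ≃ (PE r z (suc i) i ++ z (suc i))
    PEbody-top r z i g = begin
        L g (PEbody r z n i)
      ≡⟨ PEbody-split r z n i g ⟩
        L g (PE r z n i) + ΣQ n (λ k → L g (PEterm r z n i (suc k)))
      ≡⟨ cong (L g (PE r z n i) +_) (ΣQ-suc i _) ⟩
        L g (PE r z n i) + (L g (PEterm r z n i 1) + ΣQ i (λ k → L g (PEterm r z n i (suc (suc k)))))
      ≡⟨ cong (λ a → L g (PE r z n i) + (a + ΣQ i (λ k → L g (PEterm r z n i (suc (suc k)))))) (PEterm-top r z i g) ⟩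
        L g (PE r z n i) + (L g (z n) + ΣQ i (λ k → L g (PEterm r z n i (suc (suc k)))))
      ≡⟨ cong (λ a → L g (PE r z n i) + (L g (z n) + a)) (ΣQ-vanish i (λ k _ → PEterm-vanish r z n i (suc (suc k)) g
           (NP.<⇒≱ (NP.m<m+n (suc i) {suc i ℕ.+ k ℕ.* suc i} (s≤s z≤n))))) ⟩
        L g (PE r z n i) + (L g (z n) + 0ℚ)
      ≡⟨ cong (L g (PE r z n i) +_) (QP.+-identityʳ _) ⟩
        L g (PE r z n i) + L g (z n)
      ≡⟨ sym (L-++ g (PE r z n i) (z n)) ⟩
        L g (PE r z n i ++ z n) ∎
      where
      open ≡-Reasoning
      n : ℕ
      n = suc i

    -- The occurrence of z_n inside PE r z n n: z_n itself (from e^{z_n}) if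
    -- r ∤ n, and 0 if r ∣ n (the factor e^{z_n} is omitted).
    extraT : ℕ → (ℕ → LC B) → ℕ → LC B
    extraT r z n = ifDec (r ∣? n) [] (z n)

    PE-extract : ∀ r z i → PE r z (suc i) (suc i) ≃ (PE r (kill (suc i) z) (suc i) (suc i) ++ extraT r z (suc i))
    PE-extract r z i with r ∣? suc i
    ... | yes _ = λ g → trans (PE-kill-len r z (suc i) i NP.≤-refl (suc i) g)
                              (sym (trans (L-++ g (PE r (kill (suc i) z) (suc i) i) []) (QP.+-identityʳ _)))
    ... | no _  = λ g → begin
        L g (PEbody r z n i)                     ≡⟨ PEbody-top r z i g ⟩
        L g (PE r z n i ++ z n)                  ≡⟨ L-++ g (PE r z n i) (z n) ⟩
        L g (PE r z n i) + L g (z n)             ≡⟨ cong (_+ L g (z n)) (PE-kill-len r z n i NP.≤-refl n g) ⟩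
        L g (PE r z' n i) + L g (z n)            ≡⟨ cong (_+ L g (z n)) (sym (trans (PEbody-top r z' i g) killed-top)) ⟩
        L g (PEbody r z' n i) + L g (z n)        ≡⟨ sym (L-++ g (PEbody r z' n i) (z n)) ⟩
        L g (PEbody r z' n i ++ z n) ∎
      where
      open ≡-Reasoning
      n : ℕ
      n = suc i
      z' : ℕ → LC B
      z' = kill n z
      killed-top : ∀ {g} → L g (PE r z' n i ++ z' n) ≡ L g (PE r z' n i)
      killed-top {g} = trans (cong (λ a → L g (PE r z' n i ++ a)) (kill-eq n z))
                         (trans (L-++ g (PE r z' n i) []) (QP.+-identityʳ _))

    -- Lowest-order extraction: for z 0 = 1 and n ≥ 1, the entry z_n enters
    -- RD r z n exactly once and linearly, either as z_0 · z_n from e^{z_n}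
    -- (when r ∤ n) or as the leading factor z_{(n/r) r} (when r ∣ n).  Hence
    -- RD r z n = RD r (kill n z) n + z_n, which is what makes the defining
    -- relation of the Zassenhaus elements triangular.
    module Extraction (r : ℕ) .{{_ : NonZero r}} (z : ℕ → LC B) (i : ℕ) (z0 : z 0 ≃ one) where

      n : ℕ
      n = suc i

      z' : ℕ → LC B
      z' = kill n z

      term-value : ∀ y g p → p ℕ.* r ≤ n → L g (RDterm r y n p) ≡ L g (mul (y (p ℕ.* r)) (PE r y (n ∸ p ℕ.* r) n))
      term-value y g p pr≤n = trans (L-if g (p ℕ.* r ≤ᵇ n) _) (≡1⇒*≡id _ (Ind≤-yes pr≤n))

      term-absent : ∀ y g p → ¬ p ℕ.* r ≤ n → L g (RDterm r y n p) ≡ 0ℚ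
      term-absent y g p pr≰n = trans (L-if g (p ℕ.* r ≤ᵇ n) _) (≡0⇒*≡0 _ (Ind≤-no pr≰n))

      -- t is the index of the unique term of RD r z n in which z_n occurs.
      module AtIndex (t : ℕ) (hit⇒t : ∀ p → p ℕ.* r ≡ n → p ≡ t) (t⇒hit : ∀ p → p ≡ t → ¬ p ≡ 0 → p ℕ.* r ≡ n)
                     (extra-at-0 : ∀ g → L g (extraT r z n) ≡ IndD (0 ℕ.≟ t) * L g (z n)) where
        open ≡-Reasoning

        Claim : (B → ℚ) → ℕ → Set
        Claim g p = L g (RDterm r z n p) ≡ L g (RDterm r z' n p) + IndD (p ℕ.≟ t) * L g (z n)

        no-extra : ∀ g p → ¬ p ≡ t → L g (RDterm r z n p) ≡ L g (RDterm r z' n p) → Claim g p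
        no-extra g p p≢t e = trans e (sym (trans (cong (L g (RDterm r z' n p) +_) (≡0⇒*≡0 _ (IndD-no (p ℕ.≟ t) p≢t)))
                                                (QP.+-identityʳ _)))

        term-out : ∀ g p → ¬ p ℕ.* r ≤ n → Claim g p
        term-out g p pr≰n = no-extra g p p≢t (trans (term-absent z g p pr≰n) (sym (term-absent z' g p pr≰n)))
          where
          p≢t : ¬ p ≡ t
          p≢t p≡t with p ℕ.≟ 0
          ... | yes refl = pr≰n z≤n
          ... | no p≢0   = pr≰n (NP.≤-reflexive (t⇒hit p p≡t p≢0))

        term-hit : ∀ g p → p ℕ.* r ≡ n → Claim g p
        term-hit g p pr≡n = begin
            L g (RDterm r z n p)                    ≡⟨ trans (term-value z g p pr≤n) (cong (λ a → L g (mul (z a) (PE r z (n ∸ a) n))) pr≡n) ⟩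
            L g (mul (z n) (PE r z (n ∸ n) n))      ≡⟨ mul-cong {z n} (λ _ → refl) degree-0 g ⟩
            L g (mul (z n) one)                     ≡⟨ one-r (z n) g ⟩
            L g (z n)                               ≡⟨ sym (trans (cong₂ _+_ killed (≡1⇒*≡id _ (IndD-yes (p ℕ.≟ t) (hit⇒t p pr≡n))))
                                                                 (QP.+-identityˡ _)) ⟩
            L g (RDterm r z' n p) + IndD (p ℕ.≟ t) * L g (z n) ∎
          where
          pr≤n : p ℕ.* r ≤ n
          pr≤n = NP.≤-reflexive pr≡n
          degree-0 : PE r z (n ∸ n) n ≃ one
          degree-0 = subst (λ a → PE r z a n ≃ one) (sym (NP.n∸n≡0 n)) (PE-0 r z n)
          killed : L g (RDterm r z' n p) ≡ 0ℚ
          killed = begin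
            L g (RDterm r z' n p)                   ≡⟨ trans (term-value z' g p pr≤n) (cong (λ a → L g (mul (z' a) (PE r z' (n ∸ a) n))) pr≡n) ⟩
            L g (mul (z' n) (PE r z' (n ∸ n) n))    ≡⟨ cong (λ a → L g (mul a (PE r z' (n ∸ n) n))) (kill-eq n z) ⟩
            L g (mul [] (PE r z' (n ∸ n) n))        ≡⟨ mul-[]ˡ _ g ⟩
            0ℚ ∎

        term-zero : ∀ g → Claim g 0
        term-zero g = begin
            L g (RDterm r z n 0)                    ≡⟨ term-value z g 0 z≤n ⟩
            L g (mul (z 0) (PE r z n n))            ≡⟨ mul-cong {z 0} (λ _ → refl) (PE-extract r z i) g ⟩
            L g (mul (z 0) (PE r z' n n ++ extraT r z n)) ≡⟨ L-mul-++ʳ g (z 0) _ _ ⟩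
            L g (mul (z 0) (PE r z' n n)) + L g (mul (z 0) (extraT r z n))
              ≡⟨ cong₂ _+_ (mul-cong {z 0} {z' 0} (kill-ne n z 0 (λ ())) (λ _ → refl) g)
                           (trans (mul-cong z0 (λ _ → refl) g) (trans (one-l (extraT r z n) g) (extra-at-0 g))) ⟩
            L g (mul (z' 0) (PE r z' n n)) + IndD (0 ℕ.≟ t) * L g (z n)
              ≡⟨ cong (_+ IndD (0 ℕ.≟ t) * L g (z n)) (sym (term-value z' g 0 z≤n)) ⟩
            L g (RDterm r z' n 0) + IndD (0 ℕ.≟ t) * L g (z n) ∎

        -- Terms with 0 < pr < n see only entries of z below n.
        term-middle : ∀ g p → suc p ℕ.* r ≤ n → ¬ suc p ℕ.* r ≡ n → Claim g (suc p)
        term-middle g p pr≤n pr≢n = no-extra g (suc p) (λ e → pr≢n (t⇒hit (suc p) e (λ ()))) (begin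
            L g (RDterm r z n (suc p))              ≡⟨ term-value z g (suc p) pr≤n ⟩
            L g (mul (z pr) (PE r z (n ∸ pr) n))    ≡⟨ mul-cong (kill-ne n z pr pr≢n) (PE-kill-deg r z n (n ∸ pr) n∸pr<n n) g ⟩
            L g (mul (z' pr) (PE r z' (n ∸ pr) n))  ≡⟨ sym (term-value z' g (suc p) pr≤n) ⟩
            L g (RDterm r z' n (suc p)) ∎)
          where
          pr : ℕ
          pr = suc p ℕ.* r
          n∸pr<n : n ∸ pr < n
          n∸pr<n = NP.∸-monoʳ-< {n} {pr} {0} (NP.<-≤-trans (ℕ.>-nonZero⁻¹ r) (NP.m≤m+n r (p ℕ.* r))) pr≤n

        RDterm-extract : ∀ g p → Claim g p
        RDterm-extract g p = by-cases p (p ℕ.* r ℕ.≤? n) (p ℕ.* r ℕ.≟ n)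
          where
          by-cases : ∀ p → Dec (p ℕ.* r ≤ n) → Dec (p ℕ.* r ≡ n) → Claim g p
          by-cases p       (no pr≰n)  _          = term-out g p pr≰n
          by-cases p       (yes _)    (yes pr≡n) = term-hit g p pr≡n
          by-cases zero    (yes _)    (no _)     = term-zero g
          by-cases (suc p) (yes pr≤n) (no pr≢n)  = term-middle g p pr≤n pr≢n

        RD-extract-at : t < suc n → RD r z n ≃ (RD r z' n ++ z n)
        RD-extract-at t≤n g = begin
            L g (RD r z n)                                      ≡⟨ L-Σ g (suc n) (RDterm r z n) ⟩
            ΣQ (suc n) (λ p → L g (RDterm r z n p))              ≡⟨ ΣQ-cong (suc n) (λ p _ → RDterm-extract g p) ⟩
            ΣQ (suc n) (λ p → L g (RDterm r z' n p) + IndD (p ℕ.≟ t) * L g (z n)) ≡⟨ ΣQ-+ (suc n) _ _ ⟩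
            ΣQ (suc n) (λ p → L g (RDterm r z' n p)) + ΣQ (suc n) (λ p → IndD (p ℕ.≟ t) * L g (z n))
              ≡⟨ cong₂ _+_ (sym (L-Σ g (suc n) (RDterm r z' n))) (ΣQ-collapse (suc n) t (λ _ → L g (z n)) t≤n) ⟩
            L g (RD r z' n) + L g (z n)                          ≡⟨ sym (L-++ g (RD r z' n) (z n)) ⟩
            L g (RD r z' n ++ z n) ∎

      -- t = n/r when r ∣ n; t = 0 (the term z_0 · e^{z_n}) when r ∤ n.
      RD-extract : RD r z n ≃ (RD r z' n ++ z n)
      RD-extract = by-divisibility (r ∣? n)
        where
        by-divisibility : Dec (r ∣ n) → RD r z n ≃ (RD r z' n ++ z n)
        by-divisibility (yes (divides q n≡qr)) = AtIndex.RD-extract-at q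
            (λ p pr≡n → NP.*-cancelʳ-≡ p q r (trans pr≡n n≡qr))
            (λ p p≡q _ → trans (cong (ℕ._* r) p≡q) (sym n≡qr))
            (λ g → trans (cong (L g) (ifDec-yes (r ∣? n) [] (z n) (divides q n≡qr))) (sym (≡0⇒*≡0 _ (IndD-no (0 ℕ.≟ q) 0≢q))))
            (s≤s (subst (q ≤_) (sym n≡qr) (NP.m≤m*n q r)))
          where
          0≢q : ¬ 0 ≡ q
          0≢q 0≡q = NP.0≢1+n (trans (cong (ℕ._* r) 0≡q) (sym n≡qr))
        by-divisibility (no r∤n) = AtIndex.RD-extract-at 0
            (λ p pr≡n → ⊥-elim (r∤n (divides p (sym pr≡n))))
            (λ p p≡0 p≢0 → ⊥-elim (p≢0 p≡0))
            (λ g → trans (cong (L g) (ifDec-no (r ∣? n) [] (z n) r∤n)) (sym (≡1⇒*≡id _ (IndD-yes (0 ℕ.≟ 0) refl))))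
            (s≤s z≤n)

-- Arithmetic of the coefficients 1/k! of the exponential series, proved by
-- passing to unnormalised rationals.
module Factorials where

  open import Data.Nat as ℕ using (ℕ; zero; suc; _!; NonZero)
  import Data.Nat.Properties as NP
  open import Data.Nat.Properties using (_!≢0)
  open import Data.Integer as ℤ using (+_)
  import Data.Integer.Properties as ZP
  open import Data.Rational as Q using (ℚ; 1ℚ; _+_; _*_; _/_; toℚᵘ)
  import Data.Rational.Properties as QP
  open import Data.Rational.Unnormalised as U using (mkℚᵘ; *≡*) renaming (_/_ to _/ᵘ_)
  import Data.Rational.Unnormalised.Properties as UP
  open import Relation.Binary.PropositionalEquality
  open import Defs using (invFact)
  import Data.Nat.Solver as ℕSolver
  module NS = ℕSolver.+-*-Solver

  natQ : ℕ → ℚ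
  natQ n = + n / 1

  toℚᵘ-/ : ∀ i n .{{_ : NonZero n}} → toℚᵘ (i / n) U.≃ (i /ᵘ n)
  toℚᵘ-/ i (suc d) = QP.toℚᵘ-fromℚᵘ (mkℚᵘ i d)

  cancel-suc : ∀ k b .{{_ : NonZero b}} → (+ suc k /ᵘ 1) U.* ((+ 1 /ᵘ (suc k ℕ.* b)) {{NP.m*n≢0 (suc k) b}}) U.≃ (+ 1 /ᵘ b)
  cancel-suc k (suc d) = *≡* (begin
      (+ suc k ℤ.* + 1) ℤ.* + suc d    ≡⟨ cong (ℤ._* + suc d) (sym (ZP.pos-* (suc k) 1)) ⟩
      + (suc k ℕ.* 1) ℤ.* + suc d      ≡⟨ sym (ZP.pos-* (suc k ℕ.* 1) (suc d)) ⟩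
      + (suc k ℕ.* 1 ℕ.* suc d)        ≡⟨ cong +_ arith ⟩
      + (1 ℕ.* (1 ℕ.* (suc k ℕ.* suc d))) ≡⟨ ZP.pos-* 1 (1 ℕ.* (suc k ℕ.* suc d)) ⟩
      + 1 ℤ.* + (1 ℕ.* (suc k ℕ.* suc d)) ∎)
    where
    open ≡-Reasoning
    arith : suc k ℕ.* 1 ℕ.* suc d ≡ 1 ℕ.* (1 ℕ.* (suc k ℕ.* suc d))
    arith = NS.solve 2 (λ k d → ((NS.con 1 NS.:+ k) NS.:* NS.con 1) NS.:* (NS.con 1 NS.:+ d)
                              NS.:= NS.con 1 NS.:* (NS.con 1 NS.:* ((NS.con 1 NS.:+ k) NS.:* (NS.con 1 NS.:+ d)))) refl k d

  natQ*invFact : ∀ k → natQ (suc k) * invFact (suc k) ≡ invFact k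
  natQ*invFact k = QP.toℚᵘ-injective (UP.≃-trans (QP.toℚᵘ-homo-* (natQ (suc k)) (invFact (suc k)))
                     (UP.≃-trans (UP.*-cong (toℚᵘ-/ (+ suc k) 1) (toℚᵘ-/ (+ 1) (suc k !) {{suc k !≢0}}))
                     (UP.≃-trans (cancel-suc k (k !) {{k !≢0}}) (UP.≃-sym (toℚᵘ-/ (+ 1) (k !) {{k !≢0}})))))

  inv*natQ : ∀ k → (+ 1 / suc k) * natQ (suc k) ≡ 1ℚ
  inv*natQ k = QP.toℚᵘ-injective (UP.≃-trans (QP.toℚᵘ-homo-* (+ 1 / suc k) (natQ (suc k)))
                 (UP.≃-trans (UP.*-cong (toℚᵘ-/ (+ 1) (suc k)) (toℚᵘ-/ (+ suc k) 1)) (*≡* cross-multiplied)))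
    where
    open ≡-Reasoning
    arith : 1 ℕ.* suc k ℕ.* 1 ≡ 1 ℕ.* suc (k ℕ.* 1)
    arith = NS.solve 1 (λ k → (NS.con 1 NS.:* (NS.con 1 NS.:+ k)) NS.:* NS.con 1
                              NS.:= NS.con 1 NS.:* (NS.con 1 NS.:+ k NS.:* NS.con 1)) refl k
    cross-multiplied : (+ 1 ℤ.* + suc k) ℤ.* + 1 ≡ + 1 ℤ.* + suc (k ℕ.* 1)
    cross-multiplied = begin
      (+ 1 ℤ.* + suc k) ℤ.* + 1  ≡⟨ cong (ℤ._* + 1) (sym (ZP.pos-* 1 (suc k))) ⟩
      + (1 ℕ.* suc k) ℤ.* + 1    ≡⟨ sym (ZP.pos-* (1 ℕ.* suc k) 1) ⟩
      + (1 ℕ.* suc k ℕ.* 1)      ≡⟨ cong +_ arith ⟩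
      + (1 ℕ.* suc (k ℕ.* 1))    ≡⟨ ZP.pos-* 1 (suc (k ℕ.* 1)) ⟩
      + 1 ℤ.* + suc (k ℕ.* 1) ∎

  natQ-suc : ∀ n → natQ (suc n) ≡ 1ℚ + natQ n
  natQ-suc n = QP.toℚᵘ-injective (UP.≃-trans (toℚᵘ-/ (+ suc n) 1) (UP.≃-trans (*≡* cross-multiplied)
                 (UP.≃-sym (UP.≃-trans (QP.toℚᵘ-homo-+ 1ℚ (natQ n)) (UP.+-cong (UP.≃-refl {toℚᵘ 1ℚ}) (toℚᵘ-/ (+ n) 1))))))
    where
    open ≡-Reasoning
    arith : suc n ℕ.* 1 ≡ (1 ℕ.* 1 ℕ.+ n ℕ.* 1) ℕ.* 1
    arith = NS.solve 1 (λ n → (NS.con 1 NS.:+ n) NS.:* NS.con 1 NS.:= (NS.con 1 NS.:* NS.con 1 NS.:+ n NS.:* NS.con 1) NS.:* NS.con 1) refl n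
    cross-multiplied : + suc n ℤ.* + 1 ≡ (+ 1 ℤ.* + 1 ℤ.+ + n ℤ.* + 1) ℤ.* + 1
    cross-multiplied = begin
      + (suc n ℕ.* 1)                           ≡⟨ cong +_ arith ⟩
      + ((1 ℕ.* 1 ℕ.+ n ℕ.* 1) ℕ.* 1)           ≡⟨ ZP.pos-* (1 ℕ.* 1 ℕ.+ n ℕ.* 1) 1 ⟩
      + (1 ℕ.* 1 ℕ.+ n ℕ.* 1) ℤ.* + 1           ≡⟨ cong (ℤ._* + 1) (ZP.pos-+ (1 ℕ.* 1) (n ℕ.* 1)) ⟩
      (+ (1 ℕ.* 1) ℤ.+ + (n ℕ.* 1)) ℤ.* + 1     ≡⟨ cong (ℤ._* + 1) (cong₂ ℤ._+_ (ZP.pos-* 1 1) (ZP.pos-* n 1)) ⟩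
      (+ 1 ℤ.* + 1 ℤ.+ + n ℤ.* + 1) ℤ.* + 1 ∎

  natQ-+ : ∀ a b → natQ (a ℕ.+ b) ≡ natQ a + natQ b
  natQ-+ zero    b = sym (QP.+-identityˡ (natQ b))
  natQ-+ (suc a) b = begin
      natQ (suc a ℕ.+ b)          ≡⟨ natQ-suc (a ℕ.+ b) ⟩
      1ℚ + natQ (a ℕ.+ b)         ≡⟨ cong (λ x → 1ℚ + x) (natQ-+ a b) ⟩
      1ℚ + (natQ a + natQ b)      ≡⟨ sym (QP.+-assoc 1ℚ (natQ a) (natQ b)) ⟩
      (1ℚ + natQ a) + natQ b      ≡⟨ cong (_+ natQ b) (sym (natQ-suc a)) ⟩
      natQ (suc a) + natQ b ∎
    where open ≡-Reasoning

module SymInstances where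

  open import Data.Nat as ℕ using (ℕ; zero; suc; _∸_; _≤ᵇ_)
  open import Data.Rational using (ℚ; 0ℚ; 1ℚ; _+_; _*_)
  import Data.Rational.Properties as QP
  open import Data.Bool using (true; false; if_then_else_)
  open import Data.List using ([]; _∷_; _++_)
  import Data.List.Properties as LP
  import Data.Product.Properties as PP
  open import Data.Product using (_×_; _,_; proj₁; proj₂)
  open import Relation.Binary.PropositionalEquality hiding ([_])
  open import Relation.Nullary using (does; yes; no)
  open import Data.Nat.Divisibility using (_∣?_)
  open import Defs
  open LinearCombinations

  L-⊛ : ∀ g x y → L g (x ⊛ y) ≡ L (λ u → L (λ v → g (u ++ v)) y) x
  L-⊛ g = L-bilinear g _++_

  _∙⊗_ : Word × Word → Word × Word → Word × Word
  U ∙⊗ V = (proj₁ U ++ proj₁ V , proj₂ U ++ proj₂ V)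

  L-⊛⊗ : ∀ g x y → L g (x ⊛⊗ y) ≡ L (λ U → L (λ V → g (U ∙⊗ V)) y) x
  L-⊛⊗ g = L-bilinear g _∙⊗_

  L-⊗ : ∀ g x y → L g (x ⊗ y) ≡ L (λ u → L (λ v → g (u , v)) y) x
  L-⊗ g = L-bilinear g _,_

  ∙⊗-assoc : ∀ a b c → (a ∙⊗ b) ∙⊗ c ≡ a ∙⊗ (b ∙⊗ c)
  ∙⊗-assoc (a , a') (b , b') (c , c') = cong₂ _,_ (LP.++-assoc a b c) (LP.++-assoc a' b' c')

  ∙⊗-idʳ : ∀ a → a ∙⊗ ([] , []) ≡ a
  ∙⊗-idʳ (a , a') = cong₂ _,_ (LP.++-identityʳ a) (LP.++-identityʳ a')

  module SymAlg = MonoidAlgebra _++_ [] LP.++-assoc (λ _ → refl) LP.++-identityʳ _⊛_ L-⊛ scale L-scaleLC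
  module TenAlg = MonoidAlgebra _∙⊗_ ([] , []) ∙⊗-assoc (λ _ → refl) ∙⊗-idʳ _⊛⊗_ L-⊛⊗ scale⊗ L-scaleLC

  δ⊗ : Word × Word → Word × Word → ℚ
  δ⊗ w u = if does (PP.≡-dec (LP.≡-dec ℕ._≟_) (LP.≡-dec ℕ._≟_) w u) then 1ℚ else 0ℚ

  coeff⊗-L : ∀ x w → coeff⊗ x w ≡ L (δ⊗ w) x
  coeff⊗-L [] w = refl
  coeff⊗-L ((c , u) ∷ x) w with does (PP.≡-dec (LP.≡-dec ℕ._≟_) (LP.≡-dec ℕ._≟_) w u)
  ... | true  = trans (cong (c +_) (coeff⊗-L x w)) (cong (_+ L (δ⊗ w) x) (sym (QP.*-identityʳ c)))
  ... | false = trans (coeff⊗-L x w) (sym (trans (cong (_+ L (δ⊗ w) x) (QP.*-zeroʳ c)) (QP.+-identityˡ _)))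

  ≃⇒≈⊗ : ∀ {x y} → x ≃ y → x ≈⊗ y
  ≃⇒≈⊗ {x} {y} e w = trans (coeff⊗-L x w) (trans (e (δ⊗ w)) (sym (coeff⊗-L y w)))

  pow≡pw : ∀ x k → pow x k ≡ SymAlg.pw x k
  pow≡pw x zero    = refl
  pow≡pw x (suc k) = cong (x ⊛_) (pow≡pw x k)

  prodExp≃PE : ∀ r z m i → prodExp r z m i ≃ SymAlg.PE r z m i
  prodExp≃PE r z m zero g = refl
  prodExp≃PE r z m (suc i) with r ∣? suc i
  ... | yes _ = prodExp≃PE r z m i
  ... | no _  = Σ-cong (suc m) term (SymAlg.PEterm r z m i) (λ k _ →
                  if-cong (k ℕ.* suc i ≤ᵇ m) (SymAlg.sc-cong (invFact k) {pow (z (suc i)) k ⊛ prodExp r z (m ∸ k ℕ.* suc i) i}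
                                              {SymAlg.pw (z (suc i)) k ⊛ SymAlg.PE r z (m ∸ k ℕ.* suc i) i}
                    (SymAlg.mul-cong {pow (z (suc i)) k} {SymAlg.pw (z (suc i)) k}
                                     {prodExp r z (m ∸ k ℕ.* suc i) i} {SymAlg.PE r z (m ∸ k ℕ.* suc i) i}
                      (λ g → cong (L g) (pow≡pw (z (suc i)) k)) (prodExp≃PE r z (m ∸ k ℕ.* suc i) i))))
    where
    term : ℕ → Sym
    term k = if k ℕ.* suc i ≤ᵇ m then scale (invFact k) (pow (z (suc i)) k ⊛ prodExp r z (m ∸ k ℕ.* suc i) i) else []

  rhsDeg≃RD : ∀ r z n → rhsDeg r z n ≃ SymAlg.RD r z n
  rhsDeg≃RD r z n = Σ-cong (suc n) term (SymAlg.RDterm r z n) (λ p _ →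
    if-cong (p ℕ.* r ≤ᵇ n) (SymAlg.mul-cong {z (p ℕ.* r)} {z (p ℕ.* r)} {prodExp r z (n ∸ p ℕ.* r) n} {SymAlg.PE r z (n ∸ p ℕ.* r) n}
      (λ g → refl) (prodExp≃PE r z (n ∸ p ℕ.* r) n)))
    where
    term : ℕ → Sym
    term p = if p ℕ.* r ≤ᵇ n then z (p ℕ.* r) ⊛ prodExp r z (n ∸ p ℕ.* r) n else []

module ZassenhausRecursion where

  open import Data.Nat as ℕ using (ℕ; zero; suc; _≤_; _<_; s≤s; NonZero)
  import Data.Nat.Properties as NP
  open import Data.Rational using (1ℚ; _+_; _*_; -_)
  open import Data.Rational.Solver using (module +-*-Solver)
  open +-*-Solver using (solve; _:+_; _:*_; :-_; con; _:=_)
  open import Data.List using ([]; _∷_; _++_; [_]; length)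
  import Data.List.Properties as LP
  open import Relation.Binary.PropositionalEquality hiding ([_])
  open import Relation.Nullary using (yes; no)
  open import Defs
  open LinearCombinations
  open SymInstances

  lookupD-++ˡ : ∀ xs ys j → j < length xs → lookupD (xs ++ ys) j ≡ lookupD xs j
  lookupD-++ˡ (x ∷ xs) ys zero    _        = refl
  lookupD-++ˡ (x ∷ xs) ys (suc j) (s≤s lt) = lookupD-++ˡ xs ys j lt

  lookupD-last : ∀ xs y → lookupD (xs ++ [ y ]) (length xs) ≡ y
  lookupD-last []       y = refl
  lookupD-last (x ∷ xs) y = lookupD-last xs y

  lookupD-out : ∀ xs j → length xs ≤ j → lookupD xs j ≡ []
  lookupD-out []       j       _        = refl
  lookupD-out (x ∷ xs) (suc j) (s≤s le) = lookupD-out xs j le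

  module _ (r : ℕ) .{{_ : NonZero r}} where

    length-zetaList : ∀ n → length (zetaList r n) ≡ suc n
    length-zetaList zero    = refl
    length-zetaList (suc n) =
      trans (LP.length-++ (zetaList r n)) (trans (cong (ℕ._+ 1) (length-zetaList n)) (NP.+-comm (suc n) 1))

    zetaList-entry : ∀ n j → j ≤ n → lookupD (zetaList r n) j ≡ ζ r j
    zetaList-entry zero    zero _  = refl
    zetaList-entry (suc n) j    le with j ℕ.≟ suc n
    ... | yes refl = refl
    ... | no j≢    = trans (lookupD-++ˡ (zetaList r n) _ j (subst (j <_) (sym (length-zetaList n)) (NP.≤∧≢⇒< le j≢)))
                           (zetaList-entry n j (NP.≤-pred (NP.≤∧≢⇒< le j≢)))

    ζ-suc : ∀ n → ζ r (suc n) ≡ S (suc n) ⊕ neg (rhsDeg r (lookupD (zetaList r n)) (suc n))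
    ζ-suc n = trans (cong (lookupD (zetaList r n ++ _)) (sym (length-zetaList n))) (lookupD-last (zetaList r n) _)

    ζ-0 : ζ r 0 ≃ SymAlg.one
    ζ-0 g = refl

    -- The defining relation  S_n = [degree n of (Σ_p ζ_{pr}) ∏ e^{ζ_i}]  holds:
    -- by extraction, the degree-n part equals ζ_n plus the same expression with
    -- ζ_n := 0, which is S_n - ζ_n by the recursive definition of ζ_n.
    defining-relation : ∀ n → S n ≃ SymAlg.RD r (ζ r) n
    defining-relation zero g = sym (SymAlg.RD-0 r (ζ r) ζ-0 g)
    defining-relation (suc n) g = sym (begin
        L g (SymAlg.RD r (ζ r) N)
      ≡⟨ Extraction.RD-extract r (ζ r) n ζ-0 g ⟩
        L g (SymAlg.RD r (SymAlg.kill N (ζ r)) N ++ ζ r N)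
      ≡⟨ L-++ g (SymAlg.RD r (SymAlg.kill N (ζ r)) N) (ζ r N) ⟩
        L g (SymAlg.RD r (SymAlg.kill N (ζ r)) N) + L g (ζ r N)
      ≡⟨ cong₂ _+_ (trans (SymAlg.RD-cong r {SymAlg.kill N (ζ r)} {earlier} N killed≃earlier g) (sym (rhsDeg≃RD r earlier N g))) (cong (L g) (ζ-suc n)) ⟩
        L g (rhsDeg r earlier N) + L g (S N ⊕ neg (rhsDeg r earlier N))
      ≡⟨ cong (L g (rhsDeg r earlier N) +_) (trans (L-++ g (S N) (neg (rhsDeg r earlier N))) (cong (L g (S N) +_) (L-scaleLC g (- 1ℚ) (rhsDeg r earlier N)))) ⟩
        L g (rhsDeg r earlier N) + (L g (S N) + (- 1ℚ) * L g (rhsDeg r earlier N))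
      ≡⟨ solve 2 (λ a b → a :+ (b :+ (:- con 1ℚ) :* a) := b) refl (L g (rhsDeg r earlier N)) (L g (S N)) ⟩
        L g (S N) ∎)
      where
      open ≡-Reasoning
      module Extraction = SymAlg.Extraction
      N : ℕ
      N = suc n
      earlier : ℕ → Sym
      earlier = lookupD (zetaList r n)
      killed≃earlier : ∀ j → j ≤ N → SymAlg.kill N (ζ r) j ≃ earlier j
      killed≃earlier j le with j ℕ.≟ N
      ... | yes refl = λ g → cong (L g) (sym (lookupD-out (zetaList r n) N (NP.≤-reflexive (length-zetaList n))))
      ... | no j≢N   = λ g → cong (L g) (sym (zetaList-entry n j (NP.≤-pred (NP.≤∧≢⇒< le j≢N))))

module CoproductMorphism where

  open import Data.Nat as ℕ using (ℕ; zero; suc; _<_; _∸_; _≤ᵇ_)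
  open import Data.Rational using (1ℚ; _+_; _*_)
  import Data.Rational.Properties as QP
  open import Data.Bool using (true; false; if_then_else_)
  open import Data.List using ([]; _∷_; _++_; map; concat; upTo)
  open import Data.Product using (_,_)
  open import Relation.Binary.PropositionalEquality hiding ([_])
  open import Relation.Nullary using (yes; no)
  open import Data.Nat.Divisibility using (_∣?_)
  open import Defs
  open FiniteSums
  open LinearCombinations
  open SymInstances

  L-Δ : ∀ g x → L g (Δ x) ≡ L (λ w → L g (Δword w)) x
  L-Δ g [] = refl
  L-Δ g ((c , w) ∷ x) = trans (L-++ g (scale⊗ c (Δword w)) (Δ x)) (cong₂ _+_ (L-scaleLC g c (Δword w)) (L-Δ g x))

  Δ-cong : ∀ {x y} → x ≃ y → Δ x ≃ Δ y
  Δ-cong {x} {y} e g = trans (L-Δ g x) (trans (e _) (sym (L-Δ g y)))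

  Δword-++ : ∀ u v → Δword (u ++ v) ≃ (Δword u ⊛⊗ Δword v)
  Δword-++ []      v g = sym (TenAlg.one-l (Δword v) g)
  Δword-++ (a ∷ u) v g = begin
      L g (ΔS a ⊛⊗ Δword (u ++ v))
        ≡⟨ TenAlg.mul-cong {ΔS a} {ΔS a} {Δword (u ++ v)} {Δword u ⊛⊗ Δword v} (λ _ → refl) (Δword-++ u v) g ⟩
      L g (ΔS a ⊛⊗ (Δword u ⊛⊗ Δword v)) ≡⟨ sym (TenAlg.mul-assoc (ΔS a) (Δword u) (Δword v) g) ⟩
      L g ((ΔS a ⊛⊗ Δword u) ⊛⊗ Δword v) ∎
    where open ≡-Reasoning

  Δ-⊛ : ∀ x y → Δ (x ⊛ y) ≃ (Δ x ⊛⊗ Δ y)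
  Δ-⊛ x y g = begin
      L g (Δ (x ⊛ y))                                 ≡⟨ L-Δ g (x ⊛ y) ⟩
      L (λ w → L g (Δword w)) (x ⊛ y)                 ≡⟨ L-⊛ _ x y ⟩
      L (λ u → L (λ v → L g (Δword (u ++ v))) y) x    ≡⟨ L-ext (λ u → L-ext (λ v → Δword-++ u v g) y) x ⟩
      L (λ u → L (λ v → L g (Δword u ⊛⊗ Δword v)) y) x ≡⟨ L-ext (λ u → L-ext (λ v → L-⊛⊗ g (Δword u) (Δword v)) y) x ⟩
      L (λ u → L (λ v → L (λ U → L (λ V → g (U ∙⊗ V)) (Δword v)) (Δword u)) y) x
        ≡⟨ L-ext (λ u → sym (L-swap (λ U v → L (λ V → g (U ∙⊗ V)) (Δword v)) (Δword u) y)) x ⟩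
      L (λ u → L (λ U → L (λ v → L (λ V → g (U ∙⊗ V)) (Δword v)) y) (Δword u)) x
        ≡⟨ L-ext (λ u → L-ext (λ U → sym (L-Δ (λ V → g (U ∙⊗ V)) y)) (Δword u)) x ⟩
      L (λ u → L (λ U → L (λ V → g (U ∙⊗ V)) (Δ y)) (Δword u)) x ≡⟨ sym (L-Δ _ x) ⟩
      L (λ U → L (λ V → g (U ∙⊗ V)) (Δ y)) (Δ x)    ≡⟨ sym (L-⊛⊗ g (Δ x) (Δ y)) ⟩
      L g (Δ x ⊛⊗ Δ y) ∎
    where open ≡-Reasoning

  Δ-scale : ∀ c x → Δ (scale c x) ≃ scale⊗ c (Δ x)
  Δ-scale c x g = trans (L-Δ g (scale c x)) (trans (L-scaleLC _ c x) (trans (cong (c *_) (sym (L-Δ g x))) (sym (L-scaleLC g c (Δ x)))))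

  Δ-one : Δ SymAlg.one ≃ TenAlg.one
  Δ-one g = trans (L-++ g (scale⊗ 1ℚ (Δword [])) []) (trans (QP.+-identityʳ _) (trans (L-scaleLC g 1ℚ TenAlg.one) (QP.*-identityˡ _)))

  Δ-pw : ∀ x k → Δ (SymAlg.pw x k) ≃ TenAlg.pw (Δ x) k
  Δ-pw x zero    = Δ-one
  Δ-pw x (suc k) g = trans (Δ-⊛ x (SymAlg.pw x k) g)
    (TenAlg.mul-cong {Δ x} {Δ x} {Δ (SymAlg.pw x k)} {TenAlg.pw (Δ x) k} (λ _ → refl) (Δ-pw x k) g)

  Δ-if : ∀ b x → Δ (if b then x else []) ≃ (if b then Δ x else [])
  Δ-if true  x g = refl
  Δ-if false x g = refl

  Δ-Σ : ∀ N (F : ℕ → Sym) → Δ (concat (map F (upTo N))) ≃ concat (map (λ k → Δ (F k)) (upTo N))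
  Δ-Σ N F g = begin
      L g (Δ (concat (map F (upTo N))))                 ≡⟨ L-Δ g (concat (map F (upTo N))) ⟩
      L (λ w → L g (Δword w)) (concat (map F (upTo N))) ≡⟨ L-Σ _ N F ⟩
      ΣQ N (λ k → L (λ w → L g (Δword w)) (F k))        ≡⟨ ΣQ-cong N (λ k _ → sym (L-Δ g (F k))) ⟩
      ΣQ N (λ k → L g (Δ (F k)))                        ≡⟨ sym (L-Σ g N (λ k → Δ (F k))) ⟩
      L g (concat (map (λ k → Δ (F k)) (upTo N))) ∎
    where open ≡-Reasoning

  Δ-PE : ∀ r z m i → Δ (SymAlg.PE r z m i) ≃ TenAlg.PE r (λ j → Δ (z j)) m i
  Δ-PE r z m zero with m ≤ᵇ 0
  ... | true  = Δ-one
  ... | false = λ g → refl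
  Δ-PE r z m (suc i) with r ∣? suc i
  ... | yes _ = Δ-PE r z m i
  ... | no _  = λ g → trans (Δ-Σ (suc m) (SymAlg.PEterm r z m i) g)
                        (Σ-cong (suc m) (λ k → Δ (SymAlg.PEterm r z m i k)) (TenAlg.PEterm r Z m i) term g)
    where
    Z : ℕ → Sym⊗
    Z j = Δ (z j)
    term : ∀ k → k < suc m → Δ (SymAlg.PEterm r z m i k) ≃ TenAlg.PEterm r Z m i k
    term k _ g = trans (Δ-if (k ℕ.* suc i ≤ᵇ m) (scale (invFact k) P) g) (if-cong (k ℕ.* suc i ≤ᵇ m) {Δ (scale (invFact k) P)} {Q} chain g)
      where
      m' : ℕ
      m' = m ∸ k ℕ.* suc i
      P : Sym
      P = SymAlg.pw (z (suc i)) k ⊛ SymAlg.PE r z m' i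
      Q : Sym⊗
      Q = scale⊗ (invFact k) (TenAlg.pw (Z (suc i)) k ⊛⊗ TenAlg.PE r Z m' i)
      chain : Δ (scale (invFact k) P) ≃ Q
      chain g = begin
          L g (Δ (scale (invFact k) P))          ≡⟨ trans (Δ-scale (invFact k) P g) (L-scaleLC g (invFact k) (Δ P)) ⟩
          invFact k * L g (Δ P)                  ≡⟨ cong (invFact k *_) (Δ-⊛ (SymAlg.pw (z (suc i)) k) (SymAlg.PE r z m' i) g) ⟩
          invFact k * L g (Δ (SymAlg.pw (z (suc i)) k) ⊛⊗ Δ (SymAlg.PE r z m' i))
            ≡⟨ cong (invFact k *_) (TenAlg.mul-cong {Δ (SymAlg.pw (z (suc i)) k)} {TenAlg.pw (Z (suc i)) k}
                   {Δ (SymAlg.PE r z m' i)} {TenAlg.PE r Z m' i} (Δ-pw (z (suc i)) k) (Δ-PE r z m' i) g) ⟩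
          invFact k * L g (TenAlg.pw (Z (suc i)) k ⊛⊗ TenAlg.PE r Z m' i)
            ≡⟨ sym (L-scaleLC g (invFact k) (TenAlg.pw (Z (suc i)) k ⊛⊗ TenAlg.PE r Z m' i)) ⟩
          L g Q ∎
        where open ≡-Reasoning

  Δ-RD : ∀ r z n → Δ (SymAlg.RD r z n) ≃ TenAlg.RD r (λ j → Δ (z j)) n
  Δ-RD r z n g = trans (Δ-Σ (suc n) (SymAlg.RDterm r z n) g)
                       (Σ-cong (suc n) (λ p → Δ (SymAlg.RDterm r z n p)) (TenAlg.RDterm r Z n) term g)
    where
    Z : ℕ → Sym⊗
    Z j = Δ (z j)
    term : ∀ p → p < suc n → Δ (SymAlg.RDterm r z n p) ≃ TenAlg.RDterm r Z n p
    term p _ g = trans (Δ-if (p ℕ.* r ≤ᵇ n) X g) (if-cong (p ℕ.* r ≤ᵇ n) {Δ X} {Z (p ℕ.* r) ⊛⊗ TenAlg.PE r Z (n ∸ p ℕ.* r) n}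
        (λ g → trans (Δ-⊛ (z (p ℕ.* r)) _ g) (TenAlg.mul-cong {Z (p ℕ.* r)} {Z (p ℕ.* r)} {Δ (SymAlg.PE r z (n ∸ p ℕ.* r) n)}
           {TenAlg.PE r Z (n ∸ p ℕ.* r) n} (λ _ → refl) (Δ-PE r z (n ∸ p ℕ.* r) n) g)) g)
      where
      X : Sym
      X = z (p ℕ.* r) ⊛ SymAlg.PE r z (n ∸ p ℕ.* r) n

module TensorProduct where

  open import Data.Nat as ℕ using (ℕ; zero; suc; _≤_; _∸_)
  import Data.Nat.Properties as NP
  open import Data.Integer as ℤ using ()
  open import Data.Rational using (ℚ; 0ℚ; 1ℚ; _+_; _*_; _/_)
  import Data.Rational.Properties as QP
  open import Data.Bool using (true; false; if_then_else_)
  open import Data.List using ([]; _++_; map; concat; upTo)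
  open import Data.Product using (_,_)
  open import Relation.Binary.PropositionalEquality hiding ([_])
  open FiniteSums
  open LinearCombinations
  open SymInstances
  open Factorials
  open import Defs

  ⊗-cong : ∀ {x x' y y'} → x ≃ x' → y ≃ y' → (x ⊗ y) ≃ (x' ⊗ y')
  ⊗-cong {x} {x'} {y} {y'} ex ey g =
    trans (L-⊗ g x y) (trans (L-ext (λ u → ey (λ v → g (u , v))) x) (trans (ex _) (sym (L-⊗ g x' y'))))

  mix : ∀ x y u v → ((x ⊗ y) ⊛⊗ (u ⊗ v)) ≃ ((x ⊛ u) ⊗ (y ⊛ v))
  mix x y u v g = begin
      L g ((x ⊗ y) ⊛⊗ (u ⊗ v)) ≡⟨ L-⊛⊗ g (x ⊗ y) (u ⊗ v) ⟩
      L (λ U → L (λ V → g (U ∙⊗ V)) (u ⊗ v)) (x ⊗ y) ≡⟨ L-⊗ _ x y ⟩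
      L (λ a → L (λ b → L (λ V → g ((a , b) ∙⊗ V)) (u ⊗ v)) y) x ≡⟨ L-ext (λ a → L-ext (λ b → L-⊗ _ u v) y) x ⟩
      L (λ a → L (λ b → L (λ c → L (λ d → g (a ++ c , b ++ d)) v) u) y) x ≡⟨ L-ext (λ a → L-swap (λ b c → L (λ d → g (a ++ c , b ++ d)) v) y u) x ⟩
      L (λ a → L (λ c → L (λ b → L (λ d → g (a ++ c , b ++ d)) v) y) u) x ≡⟨ L-ext (λ a → L-ext (λ c → sym (L-⊛ (λ t → g (a ++ c , t)) y v)) u) x ⟩
      L (λ a → L (λ c → L (λ t → g (a ++ c , t)) (y ⊛ v)) u) x ≡⟨ sym (L-⊛ _ x u) ⟩
      L (λ s → L (λ t → g (s , t)) (y ⊛ v)) (x ⊛ u) ≡⟨ sym (L-⊗ g (x ⊛ u) (y ⊛ v)) ⟩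
      L g ((x ⊛ u) ⊗ (y ⊛ v)) ∎
    where open ≡-Reasoning

  L-⊗-scl : ∀ g c x y → L g (scale c x ⊗ y) ≡ c * L g (x ⊗ y)
  L-⊗-scl g c x y = trans (L-⊗ g (scale c x) y) (trans (L-scaleLC _ c x) (cong (c *_) (sym (L-⊗ g x y))))

  L-⊗-scr : ∀ g c x y → L g (x ⊗ scale c y) ≡ c * L g (x ⊗ y)
  L-⊗-scr g c x y = trans (L-⊗ g x (scale c y)) (trans (L-ext (λ u → L-scaleLC _ c y) x) (trans (L-*g c _ x) (cong (c *_) (sym (L-⊗ g x y)))))

  L-⊗-Σl : ∀ g N (F : ℕ → Sym) y → L g (concat (map F (upTo N)) ⊗ y) ≡ ΣQ N (λ k → L g (F k ⊗ y))
  L-⊗-Σl g N F y = trans (L-⊗ g (concat (map F (upTo N))) y) (trans (L-Σ (λ u → L (λ v → g (u , v)) y) N F) (ΣQ-cong N (λ k _ → sym (L-⊗ g (F k) y))))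

  L-⊗-Σr : ∀ g N x (F : ℕ → Sym) → L g (x ⊗ concat (map F (upTo N))) ≡ ΣQ N (λ k → L g (x ⊗ F k))
  L-⊗-Σr g N x F = trans (L-⊗ g x _) (trans (L-ext (λ u → L-Σ (λ v → g (u , v)) N F) x) (trans (L-ΣQ N (λ k u → L (λ v → g (u , v)) (F k)) x) (ΣQ-cong N (λ k _ → sym (L-⊗ g x (F k))))))

  L-⊗-[]r : ∀ g x → L g (x ⊗ []) ≡ 0ℚ
  L-⊗-[]r g x = trans (L-⊗ g x []) (L-0g x)

  L-⊗-if : ∀ g b1 b2 x y → L g ((if b1 then x else []) ⊗ (if b2 then y else [])) ≡ Ind b1 * (Ind b2 * L g (x ⊗ y))
  L-⊗-if g true true x y = sym (trans (QP.*-identityˡ _) (QP.*-identityˡ _))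
  L-⊗-if g true false x y = trans (L-⊗-[]r g x) (sym (trans (QP.*-identityˡ (0ℚ * L g (x ⊗ y))) (QP.*-zeroˡ (L g (x ⊗ y)))))
  L-⊗-if g false b2 x y = sym (QP.*-zeroˡ (Ind b2 * L g (x ⊗ y)))

  -- The binomial theorem for the primitive element E = 1 ⊗ a + a ⊗ 1:
  --   E^k / k! = Σ_{j ≤ k} a^j/j! ⊗ a^{k-j}/(k-j)!,
  -- i.e. Δ(e^a) = e^a ⊗ e^a degree by degree.  Proved by induction on k via
  -- E · Q k = (k+1) · Q (k+1), a Pascal-type recurrence.
  module BinomialTheorem (a : Sym) where
    E : Sym⊗
    E = (SymAlg.one ⊗ a) ++ (a ⊗ SymAlg.one)

    e : ℕ → Sym
    e j = scale (invFact j) (SymAlg.pw a j)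

    Q : ℕ → Sym⊗
    Q k = concat (map (λ j → e j ⊗ e (k ∸ j)) (upTo (suc k)))

    a·e : ∀ j → (a ⊛ e j) ≃ scale (natQ (suc j)) (e (suc j))
    a·e j g = begin
        L g (a ⊛ e j)                          ≡⟨ SymAlg.mul-sc-r (invFact j) a (SymAlg.pw a j) g ⟩
        L g (scale (invFact j) (SymAlg.pw a (suc j))) ≡⟨ L-scaleLC g (invFact j) (SymAlg.pw a (suc j)) ⟩
        invFact j * L g (SymAlg.pw a (suc j))  ≡⟨ cong (_* L g (SymAlg.pw a (suc j))) (sym (natQ*invFact j)) ⟩
        (natQ (suc j) * invFact (suc j)) * L g (SymAlg.pw a (suc j)) ≡⟨ QP.*-assoc (natQ (suc j)) _ _ ⟩
        natQ (suc j) * (invFact (suc j) * L g (SymAlg.pw a (suc j)))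
          ≡⟨ sym (cong (natQ (suc j) *_) (L-scaleLC g (invFact (suc j)) (SymAlg.pw a (suc j)))) ⟩
        natQ (suc j) * L g (e (suc j))         ≡⟨ sym (L-scaleLC g (natQ (suc j)) (e (suc j))) ⟩
        L g (scale (natQ (suc j)) (e (suc j))) ∎
      where open ≡-Reasoning

    E·⊗ : ∀ x y g → L g (E ⊛⊗ (x ⊗ y)) ≡ L g (x ⊗ (a ⊛ y)) + L g ((a ⊛ x) ⊗ y)
    E·⊗ x y g = begin
        L g (E ⊛⊗ (x ⊗ y))
      ≡⟨ TenAlg.mul-++ˡ (SymAlg.one ⊗ a) (a ⊗ SymAlg.one) (x ⊗ y) g ⟩
        L g (((SymAlg.one ⊗ a) ⊛⊗ (x ⊗ y)) ++ ((a ⊗ SymAlg.one) ⊛⊗ (x ⊗ y)))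
      ≡⟨ L-++ g ((SymAlg.one ⊗ a) ⊛⊗ (x ⊗ y)) ((a ⊗ SymAlg.one) ⊛⊗ (x ⊗ y)) ⟩
        L g ((SymAlg.one ⊗ a) ⊛⊗ (x ⊗ y)) + L g ((a ⊗ SymAlg.one) ⊛⊗ (x ⊗ y))
      ≡⟨ cong₂ _+_ (mix SymAlg.one a x y g) (mix a SymAlg.one x y g) ⟩
        L g ((SymAlg.one ⊛ x) ⊗ (a ⊛ y)) + L g ((a ⊛ x) ⊗ (SymAlg.one ⊛ y))
      ≡⟨ cong₂ _+_ (⊗-cong {SymAlg.one ⊛ x} {x} {a ⊛ y} {a ⊛ y} (SymAlg.one-l x) (λ _ → refl) g)
                   (⊗-cong {a ⊛ x} {a ⊛ x} {SymAlg.one ⊛ y} {y} (λ _ → refl) (SymAlg.one-l y) g) ⟩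
        L g (x ⊗ (a ⊛ y)) + L g ((a ⊛ x) ⊗ y) ∎
      where open ≡-Reasoning

    E·term : ∀ k g j → j ≤ k → L g (E ⊛⊗ (e j ⊗ e (k ∸ j)))
               ≡ natQ (suc k ∸ j) * L g (e j ⊗ e (suc k ∸ j)) + natQ (suc j) * L g (e (suc j) ⊗ e (k ∸ j))
    E·term k g j j≤k = trans (E·⊗ (e j) (e (k ∸ j)) g) (cong₂ _+_
      (trans (⊗-cong {e j} {e j} (λ _ → refl) (a·e (k ∸ j)) g)
        (trans (L-⊗-scr g (natQ (suc (k ∸ j))) (e j) (e (suc (k ∸ j))))
          (subst (λ w → natQ (suc (k ∸ j)) * L g (e j ⊗ e (suc (k ∸ j))) ≡ natQ w * L g (e j ⊗ e w))
                 (sym (NP.+-∸-assoc 1 j≤k)) refl)))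
      (trans (⊗-cong {a ⊛ e j} {scale (natQ (suc j)) (e (suc j))} {e (k ∸ j)} {e (k ∸ j)} (a·e j) (λ _ → refl) g)
             (L-⊗-scl g (natQ (suc j)) (e (suc j)) (e (k ∸ j)))))

    Pascal : ∀ k g → L g (E ⊛⊗ Q k) ≡ natQ (suc k) * L g (Q (suc k))
    Pascal k g = begin
        L g (E ⊛⊗ Q k)
      ≡⟨ TenAlg.L-mul-Σʳ g (suc k) E (λ j → e j ⊗ e (k ∸ j)) ⟩
        ΣQ (suc k) (λ j → L g (E ⊛⊗ (e j ⊗ e (k ∸ j))))
      ≡⟨ ΣQ-cong (suc k) (λ j j≤k → E·term k g j (NP.≤-pred j≤k)) ⟩
        ΣQ (suc k) (λ j → natQ (suc k ∸ j) * t j + natQ (suc j) * t (suc j))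
      ≡⟨ ΣQ-+ (suc k) _ _ ⟩
        ΣQ (suc k) (λ j → natQ (suc k ∸ j) * t j) + ΣQ (suc k) (λ j → natQ (suc j) * t (suc j))
      ≡⟨ cong₂ _+_ pad-last pad-first ⟩
        ΣQ (suc (suc k)) (λ j → natQ (suc k ∸ j) * t j) + ΣQ (suc (suc k)) (λ j → natQ j * t j)
      ≡⟨ sym (ΣQ-+ (suc (suc k)) _ _) ⟩
        ΣQ (suc (suc k)) (λ j → natQ (suc k ∸ j) * t j + natQ j * t j)
      ≡⟨ ΣQ-cong (suc (suc k)) (λ j j≤ → trans (sym (QP.*-distribʳ-+ (t j) (natQ (suc k ∸ j)) (natQ j)))
           (cong (_* t j) (trans (sym (natQ-+ (suc k ∸ j) j)) (cong natQ (NP.m∸n+n≡m (NP.≤-pred j≤)))))) ⟩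
        ΣQ (suc (suc k)) (λ j → natQ (suc k) * t j)
      ≡⟨ ΣQ-*ˡ (suc (suc k)) (natQ (suc k)) t ⟩
        natQ (suc k) * ΣQ (suc (suc k)) t
      ≡⟨ cong (natQ (suc k) *_) (sym (L-Σ g (suc (suc k)) (λ j → e j ⊗ e (suc k ∸ j)))) ⟩
        natQ (suc k) * L g (Q (suc k)) ∎
      where
      open ≡-Reasoning
      t : ℕ → ℚ
      t j = L g (e j ⊗ e (suc k ∸ j))

      pad-last : ΣQ (suc k) (λ j → natQ (suc k ∸ j) * t j) ≡ ΣQ (suc (suc k)) (λ j → natQ (suc k ∸ j) * t j)
      pad-last = sym (trans (ΣQ-last (suc k) (λ j → natQ (suc k ∸ j) * t j))
                     (trans (cong (ΣQ (suc k) (λ j → natQ (suc k ∸ j) * t j) +_)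
                                  (≡0⇒*≡0 (t (suc k)) (cong natQ (NP.n∸n≡0 (suc k)))))
                            (QP.+-identityʳ _)))

      pad-first : ΣQ (suc k) (λ j → natQ (suc j) * t (suc j)) ≡ ΣQ (suc (suc k)) (λ j → natQ j * t j)
      pad-first = sym (trans (ΣQ-suc (suc k) (λ j → natQ j * t j))
                      (trans (cong (_+ ΣQ (suc k) (λ j → natQ (suc j) * t (suc j))) (QP.*-zeroˡ (t 0)))
                             (QP.+-identityˡ _)))

    Q-0 : TenAlg.one ≃ Q 0
    Q-0 g = sym (begin
        L g (e 0 ⊗ e 0 ++ [])          ≡⟨ trans (L-++ g (e 0 ⊗ e 0) []) (QP.+-identityʳ _) ⟩
        L g (e 0 ⊗ e 0)                ≡⟨ trans (L-⊗-scl g 1ℚ SymAlg.one (e 0)) (QP.*-identityˡ _) ⟩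
        L g (SymAlg.one ⊗ e 0)         ≡⟨ trans (L-⊗-scr g 1ℚ SymAlg.one SymAlg.one) (QP.*-identityˡ _) ⟩
        L g (SymAlg.one ⊗ SymAlg.one) ∎)
      where open ≡-Reasoning

    binomial : ∀ k → scale⊗ (invFact k) (TenAlg.pw E k) ≃ Q k
    binomial zero g = trans (L-scaleLC g 1ℚ TenAlg.one) (trans (QP.*-identityˡ (L g TenAlg.one)) (Q-0 g))
    binomial (suc k) g = begin
        L g (scale⊗ (invFact (suc k)) (E ⊛⊗ TenAlg.pw E k)) ≡⟨ L-scaleLC g (invFact (suc k)) (E ⊛⊗ TenAlg.pw E k) ⟩
        invFact (suc k) * X                   ≡⟨ cong (_* X) invFact-suc ⟩
        (w * invFact k) * X                   ≡⟨ QP.*-assoc w (invFact k) X ⟩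
        w * (invFact k * X)
          ≡⟨ cong (w *_) (sym (trans (TenAlg.mul-sc-r (invFact k) E (TenAlg.pw E k) g) (L-scaleLC g (invFact k) (E ⊛⊗ TenAlg.pw E k)))) ⟩
        w * L g (E ⊛⊗ scale⊗ (invFact k) (TenAlg.pw E k))
          ≡⟨ cong (w *_) (TenAlg.mul-cong {E} {E} {scale⊗ (invFact k) (TenAlg.pw E k)} {Q k} (λ _ → refl) (binomial k) g) ⟩
        w * L g (E ⊛⊗ Q k)                    ≡⟨ cong (w *_) (Pascal k g) ⟩
        w * (natQ (suc k) * L g (Q (suc k)))  ≡⟨ sym (QP.*-assoc w _ _) ⟩
        (w * natQ (suc k)) * L g (Q (suc k))  ≡⟨ cong (_* L g (Q (suc k))) (inv*natQ k) ⟩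
        1ℚ * L g (Q (suc k))                  ≡⟨ QP.*-identityˡ _ ⟩
        L g (Q (suc k)) ∎
      where
      open ≡-Reasoning
      X : ℚ
      X = L g (E ⊛⊗ TenAlg.pw E k)
      w : ℚ
      w = ℤ.+ 1 / suc k
      invFact-suc : invFact (suc k) ≡ w * invFact k
      invFact-suc = sym (trans (cong (w *_) (sym (natQ*invFact k)))
                        (trans (sym (QP.*-assoc w (natQ (suc k)) (invFact (suc k))))
                               (trans (cong (_* invFact (suc k)) (inv*natQ k)) (QP.*-identityˡ _))))

module GroupLike where

  open import Data.Nat as ℕ using (ℕ; zero; suc; _≤_; _<_; _∸_; _≤ᵇ_; NonZero)
  import Data.Nat.Properties as NP
  open import Data.Nat.DivMod using (_/_; m*n/n≡m)
  open import Data.Nat.Divisibility using (_∣?_; _∣_; divides)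
  open import Data.Rational using (ℚ; 0ℚ; _+_; _*_)
  import Data.Rational.Properties as QP
  open import Data.List using ([]; _++_; map; concat; upTo)
  open import Data.Product using (_×_)
  open import Relation.Binary.PropositionalEquality hiding ([_])
  open import Relation.Nullary using (¬_; yes; no)
  open import Defs
  open FiniteSums
  open LinearCombinations
  open SymInstances
  open TensorProduct
  open SumReindexing

  convolve : (ℕ → Sym) → ℕ → Sym⊗
  convolve f m = concat (map (λ a → f a ⊗ f (m ∸ a)) (upTo (suc m)))

  -- Induction on the number i of factors; a new factor
  -- e^{Z_s} is expanded by the binomial theorem and the resulting triple sum
  -- is reindexed.
  module ProductOfExponentials (r : ℕ) .{{_ : NonZero r}} (z : ℕ → Sym) (Z : ℕ → Sym⊗)
                               (Z-primitive : ∀ j → ¬ (r ∣ j) → Z j ≃ BinomialTheorem.E (z j)) where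

    P : ℕ → ℕ → Sym
    P a i = SymAlg.PE r z a i

    -- Adding a factor e^{Z_s}, s = i + 1 with r ∤ s, to a product that is already
    -- group-like: both sides become the triple sums of the reindexing lemma with
    -- weights T g j l b c = g-value of (z_s^j/j! · P b i) ⊗ (z_s^l/l! · P c i).
    module NewFactor (i : ℕ) (r∤s : ¬ (r ∣ suc i)) (IH : ∀ m → TenAlg.PE r Z m i ≃ convolve (λ a → P a i) m)
                     (m : ℕ) where
      open ≡-Reasoning

      s : ℕ
      s = suc i

      e : ℕ → Sym
      e = BinomialTheorem.e (z s)

      T : (Word × Word → ℚ) → ℕ → ℕ → ℕ → ℕ → ℚ
      T g j l b c = L g ((e j ⊛ P b i) ⊗ (e l ⊛ P c i))

      power-times-rest : ∀ g k → L g (scale⊗ (invFact k) (TenAlg.pw (Z s) k ⊛⊗ TenAlg.PE r Z (m ∸ k ℕ.* s) i))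
                         ≡ ΣQ (suc k) (λ j → ΣQ (suc (m ∸ k ℕ.* s)) (λ b → T g j (k ∸ j) b (m ∸ k ℕ.* s ∸ b)))
      power-times-rest g k = begin
          L g (scale⊗ (invFact k) (TenAlg.pw (Z s) k ⊛⊗ rest))
        ≡⟨ sym (TenAlg.mul-sc-l (invFact k) (TenAlg.pw (Z s) k) rest g) ⟩
          L g (scale⊗ (invFact k) (TenAlg.pw (Z s) k) ⊛⊗ rest)
        ≡⟨ TenAlg.mul-cong {scale⊗ (invFact k) (TenAlg.pw (Z s) k)} {BinomialTheorem.Q (z s) k} {rest} {convolve (λ a → P a i) m'}
             binomial (IH m') g ⟩
          L g (BinomialTheorem.Q (z s) k ⊛⊗ convolve (λ a → P a i) m')
        ≡⟨ TenAlg.L-mul-Σˡ g (suc k) (λ j → e j ⊗ e (k ∸ j)) (convolve (λ a → P a i) m') ⟩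
          ΣQ (suc k) (λ j → L g ((e j ⊗ e (k ∸ j)) ⊛⊗ convolve (λ a → P a i) m'))
        ≡⟨ ΣQ-cong (suc k) (λ j _ → trans (TenAlg.L-mul-Σʳ g (suc m') (e j ⊗ e (k ∸ j)) (λ b → P b i ⊗ P (m' ∸ b) i))
             (ΣQ-cong (suc m') (λ b _ → mix (e j) (e (k ∸ j)) (P b i) (P (m' ∸ b) i) g))) ⟩
          ΣQ (suc k) (λ j → ΣQ (suc m') (λ b → T g j (k ∸ j) b (m' ∸ b))) ∎
        where
        m' : ℕ
        m' = m ∸ k ℕ.* s
        rest : Sym⊗
        rest = TenAlg.PE r Z m' i
        binomial : scale⊗ (invFact k) (TenAlg.pw (Z s) k) ≃ BinomialTheorem.Q (z s) k
        binomial g = trans (TenAlg.sc-cong (invFact k) {TenAlg.pw (Z s) k} {TenAlg.pw (BinomialTheorem.E (z s)) k}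
                                           (TenAlg.pw-cong k (Z-primitive s r∤s)) g)
                           (BinomialTheorem.binomial (z s) k g)

      tensor-side : ∀ g → L g (TenAlg.PEbody r Z m i) ≡ Reindexing.LHS s m (T g)
      tensor-side g = trans (L-Σ g (suc m) (TenAlg.PEterm r Z m i))
        (ΣQ-cong (suc m) (λ k _ → trans (L-if g (k ℕ.* s ≤ᵇ m) _) (cong (Ind (k ℕ.* s ≤ᵇ m) *_) (power-times-rest g k))))

      term-product : ∀ g a j l → L g (SymAlg.PEterm r z a i j ⊗ SymAlg.PEterm r z (m ∸ a) i l)
                       ≡ Ind (j ℕ.* s ≤ᵇ a) * (Ind (l ℕ.* s ≤ᵇ m ∸ a) * T g j l (a ∸ j ℕ.* s) (m ∸ a ∸ l ℕ.* s))
      term-product g a j l = trans (L-⊗-if g (j ℕ.* s ≤ᵇ a) (l ℕ.* s ≤ᵇ m ∸ a) left right)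
        (cong (λ q → Ind (j ℕ.* s ≤ᵇ a) * (Ind (l ℕ.* s ≤ᵇ m ∸ a) * q))
          (⊗-cong {left} {e j ⊛ P (a ∸ j ℕ.* s) i} {right} {e l ⊛ P (m ∸ a ∸ l ℕ.* s) i}
            (λ g → sym (SymAlg.mul-sc-l (invFact j) (SymAlg.pw (z s) j) (P (a ∸ j ℕ.* s) i) g))
            (λ g → sym (SymAlg.mul-sc-l (invFact l) (SymAlg.pw (z s) l) (P (m ∸ a ∸ l ℕ.* s) i) g)) g))
        where
        left : Sym
        left = scale (invFact j) (SymAlg.pw (z s) j ⊛ P (a ∸ j ℕ.* s) i)
        right : Sym
        right = scale (invFact l) (SymAlg.pw (z s) l ⊛ P (m ∸ a ∸ l ℕ.* s) i)

      convolution-side : ∀ g → L g (convolve (λ a → SymAlg.PEbody r z a i) m) ≡ Reindexing.RHS s m (T g)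
      convolution-side g = trans (L-Σ g (suc m) (λ a → SymAlg.PEbody r z a i ⊗ SymAlg.PEbody r z (m ∸ a) i))
        (ΣQ-cong (suc m) (λ a _ → begin
           L g (SymAlg.PEbody r z a i ⊗ SymAlg.PEbody r z (m ∸ a) i)
         ≡⟨ L-⊗-Σl g (suc a) (SymAlg.PEterm r z a i) (SymAlg.PEbody r z (m ∸ a) i) ⟩
           ΣQ (suc a) (λ j → L g (SymAlg.PEterm r z a i j ⊗ SymAlg.PEbody r z (m ∸ a) i))
         ≡⟨ ΣQ-cong (suc a) (λ j _ → trans (L-⊗-Σr g (suc (m ∸ a)) (SymAlg.PEterm r z a i j) (SymAlg.PEterm r z (m ∸ a) i))
              (trans (ΣQ-cong (suc (m ∸ a)) (λ l _ → term-product g a j l))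
                (ΣQ-*ˡ (suc (m ∸ a)) (Ind (j ℕ.* s ≤ᵇ a)) (λ l → Ind (l ℕ.* s ≤ᵇ m ∸ a) * T g j l (a ∸ j ℕ.* s) (m ∸ a ∸ l ℕ.* s))))) ⟩
           ΣQ (suc a) (λ j → Ind (j ℕ.* s ≤ᵇ a) *
             ΣQ (suc (m ∸ a)) (λ l → Ind (l ℕ.* s ≤ᵇ m ∸ a) * T g j l (a ∸ j ℕ.* s) (m ∸ a ∸ l ℕ.* s))) ∎))

      PEbody-grouplike : TenAlg.PEbody r Z m i ≃ convolve (λ a → SymAlg.PEbody r z a i) m
      PEbody-grouplike g = trans (tensor-side g) (trans (Reindexing.reindex s m (T g)) (sym (convolution-side g)))

    PE-grouplike : ∀ i m → TenAlg.PE r Z m i ≃ convolve (λ a → P a i) m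
    PE-grouplike zero zero g = sym (trans (L-++ g (SymAlg.one ⊗ SymAlg.one) []) (QP.+-identityʳ _))
    PE-grouplike zero (suc m) g = sym (trans (L-Σ g (suc (suc m)) (λ a → P a 0 ⊗ P (suc m ∸ a) 0))
                                            (ΣQ-vanish (suc (suc m)) positive-degree))
      where
      positive-degree : ∀ a → a < suc (suc m) → L g (P a 0 ⊗ P (suc m ∸ a) 0) ≡ 0ℚ
      positive-degree zero    _ = L-⊗-[]r g SymAlg.one
      positive-degree (suc a) _ = refl
    PE-grouplike (suc i) m with r ∣? suc i
    ... | yes _   = PE-grouplike i m
    ... | no r∤s  = NewFactor.PEbody-grouplike i r∤s (PE-grouplike i) m

  module PredictedCoproduct (r : ℕ) .{{_ : NonZero r}} (z : ℕ → Sym) where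

    Δ-divisible : ℕ → Sym⊗
    Δ-divisible j = concat (map (λ i → z (i ℕ.* r) ⊗ z (j ∸ i ℕ.* r)) (upTo (suc (j / r))))

    Δ-primitive : ℕ → Sym⊗
    Δ-primitive j = (SymAlg.one ⊗ z j) ++ (z j ⊗ SymAlg.one)

    Δ-predicted : ℕ → Sym⊗
    Δ-predicted j = ifDec (r ∣? j) (Δ-divisible j) (Δ-primitive j)

    predicted-primitive : ∀ j → ¬ (r ∣ j) → Δ-predicted j ≃ Δ-primitive j
    predicted-primitive j r∤j g = cong (L g) (ifDec-no (r ∣? j) (Δ-divisible j) (Δ-primitive j) r∤j)

    predicted-divisible : ∀ j → r ∣ j → Δ-predicted j ≃ Δ-divisible j
    predicted-divisible j r∣j g = cong (L g) (ifDec-yes (r ∣? j) (Δ-divisible j) (Δ-primitive j) r∣j)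

    open ProductOfExponentials r z Δ-predicted predicted-primitive

    PE-stable : ∀ x b n → x ≤ b → b ≤ n → P x b ≃ P x n
    PE-stable x b n x≤b b≤n g =
      trans (SymAlg.PE-stab* r z x b x≤b g) (sym (SymAlg.PE-stab* r z x n (NP.≤-trans x≤b b≤n) g))

    module _ (n : ℕ) where
      open ≡-Reasoning

      T : (Word × Word → ℚ) → ℕ → ℕ → ℕ → ℕ → ℚ
      T g q q' x y = L g ((z (q ℕ.* r) ⊛ P x n) ⊗ (z (q' ℕ.* r) ⊛ P y n))

      tensor-term : ∀ g p → L g (Δ-predicted (p ℕ.* r) ⊛⊗ TenAlg.PE r Δ-predicted (n ∸ p ℕ.* r) n)
                            ≡ ΣQ (suc p) (λ i → ΣQ (suc (n ∸ p ℕ.* r)) (λ a → T g i (p ∸ i) a (n ∸ p ℕ.* r ∸ a)))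
      tensor-term g p = begin
          L g (Δ-predicted pr ⊛⊗ TenAlg.PE r Δ-predicted m' n)
        ≡⟨ TenAlg.mul-cong {Δ-predicted pr} {Δ-divisible pr} {TenAlg.PE r Δ-predicted m' n} {convolve (λ a → P a n) m'}
             (predicted-divisible pr (divides p refl)) (PE-grouplike n m') g ⟩
          L g (Δ-divisible pr ⊛⊗ convolve (λ a → P a n) m')
        ≡⟨ TenAlg.L-mul-Σˡ g (suc (pr / r)) (λ i → z (i ℕ.* r) ⊗ z (pr ∸ i ℕ.* r)) (convolve (λ a → P a n) m') ⟩
          ΣQ (suc (pr / r)) (λ i → L g ((z (i ℕ.* r) ⊗ z (pr ∸ i ℕ.* r)) ⊛⊗ convolve (λ a → P a n) m'))
        ≡⟨ cong (λ u → ΣQ (suc u) (λ i → L g ((z (i ℕ.* r) ⊗ z (pr ∸ i ℕ.* r)) ⊛⊗ convolve (λ a → P a n) m'))) (m*n/n≡m p r) ⟩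
          ΣQ (suc p) (λ i → L g ((z (i ℕ.* r) ⊗ z (pr ∸ i ℕ.* r)) ⊛⊗ convolve (λ a → P a n) m'))
        ≡⟨ ΣQ-cong (suc p) (λ i _ → trans (cong (λ u → L g ((z (i ℕ.* r) ⊗ z u) ⊛⊗ convolve (λ a → P a n) m')) (sym (NP.*-distribʳ-∸ r p i)))
             (trans (TenAlg.L-mul-Σʳ g (suc m') (z (i ℕ.* r) ⊗ z ((p ∸ i) ℕ.* r)) (λ a → P a n ⊗ P (m' ∸ a) n))
               (ΣQ-cong (suc m') (λ a _ → mix (z (i ℕ.* r)) (z ((p ∸ i) ℕ.* r)) (P a n) (P (m' ∸ a) n) g)))) ⟩
          ΣQ (suc p) (λ i → ΣQ (suc m') (λ a → T g i (p ∸ i) a (m' ∸ a))) ∎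
        where
        pr : ℕ
        pr = p ℕ.* r
        m' : ℕ
        m' = n ∸ pr

      term-product : ∀ g b q q' → b ≤ n → L g (SymAlg.RDterm r z b q ⊗ SymAlg.RDterm r z (n ∸ b) q')
                       ≡ Ind (q ℕ.* r ≤ᵇ b) * (Ind (q' ℕ.* r ≤ᵇ n ∸ b) * T g q q' (b ∸ q ℕ.* r) (n ∸ b ∸ q' ℕ.* r))
      term-product g b q q' b≤n = trans (L-⊗-if g (q ℕ.* r ≤ᵇ b) (q' ℕ.* r ≤ᵇ n ∸ b) _ _)
          (cong (λ u → Ind (q ℕ.* r ≤ᵇ b) * (Ind (q' ℕ.* r ≤ᵇ n ∸ b) * u))
            (⊗-cong {z (q ℕ.* r) ⊛ P (b ∸ q ℕ.* r) b} {z (q ℕ.* r) ⊛ P (b ∸ q ℕ.* r) n}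
                    {z (q' ℕ.* r) ⊛ P (n ∸ b ∸ q' ℕ.* r) (n ∸ b)} {z (q' ℕ.* r) ⊛ P (n ∸ b ∸ q' ℕ.* r) n}
               (SymAlg.mul-cong {z (q ℕ.* r)} {z (q ℕ.* r)} (λ _ → refl)
                 (PE-stable (b ∸ q ℕ.* r) b n (NP.m∸n≤m b (q ℕ.* r)) b≤n))
               (SymAlg.mul-cong {z (q' ℕ.* r)} {z (q' ℕ.* r)} (λ _ → refl)
                 (PE-stable (n ∸ b ∸ q' ℕ.* r) (n ∸ b) n (NP.m∸n≤m (n ∸ b) (q' ℕ.* r)) (NP.m∸n≤m n b))) g))

      RD-grouplike : convolve (SymAlg.RD r z) n ≃ TenAlg.RD r Δ-predicted n
      RD-grouplike g = begin
          L g (convolve (SymAlg.RD r z) n)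
        ≡⟨ L-Σ g (suc n) (λ b → SymAlg.RD r z b ⊗ SymAlg.RD r z (n ∸ b)) ⟩
          ΣQ (suc n) (λ b → L g (SymAlg.RD r z b ⊗ SymAlg.RD r z (n ∸ b)))
        ≡⟨ ΣQ-cong (suc n) (λ b b≤n → trans (L-⊗-Σl g (suc b) (SymAlg.RDterm r z b) (SymAlg.RD r z (n ∸ b)))
             (ΣQ-cong (suc b) (λ q _ → trans (L-⊗-Σr g (suc (n ∸ b)) (SymAlg.RDterm r z b q) (SymAlg.RDterm r z (n ∸ b)))
               (trans (ΣQ-cong (suc (n ∸ b)) (λ q' _ → term-product g b q q' (NP.≤-pred b≤n)))
                 (ΣQ-*ˡ (suc (n ∸ b)) (Ind (q ℕ.* r ≤ᵇ b)) (λ q' → Ind (q' ℕ.* r ≤ᵇ n ∸ b) * T g q q' (b ∸ q ℕ.* r) (n ∸ b ∸ q' ℕ.* r))))))) ⟩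
          Reindexing.RHS r n (T g)
        ≡⟨ sym (Reindexing.reindex r n (T g)) ⟩
          Reindexing.LHS r n (T g)
        ≡⟨ ΣQ-cong (suc n) (λ p _ → cong (Ind (p ℕ.* r ≤ᵇ n) *_) (sym (tensor-term g p))) ⟩
          ΣQ (suc n) (λ p → Ind (p ℕ.* r ≤ᵇ n) * L g (Δ-predicted (p ℕ.* r) ⊛⊗ TenAlg.PE r Δ-predicted (n ∸ p ℕ.* r) n))
        ≡⟨ ΣQ-cong (suc n) (λ p _ → sym (L-if g (p ℕ.* r ≤ᵇ n) _)) ⟩
          ΣQ (suc n) (λ p → L g (TenAlg.RDterm r Δ-predicted n p))
        ≡⟨ sym (L-Σ g (suc n) (TenAlg.RDterm r Δ-predicted n)) ⟩
          L g (TenAlg.RD r Δ-predicted n) ∎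

module CoproductOfZassenhaus where

  open import Data.Nat as ℕ using (ℕ; zero; suc; _≤_; _<_; _∸_; NonZero)
  import Data.Nat.Properties as NP
  open import Data.Nat.Induction using (<-rec)
  open import Data.Nat.DivMod using (_/_; 0/n≡0)
  open import Data.Nat.Divisibility using (divides)
  open import Data.Rational using (ℚ; 0ℚ; 1ℚ; _+_; _*_)
  import Data.Rational.Properties as QP
  open import Data.List using (map; concat; upTo; [_])
  import Data.List.Properties as LP
  open import Data.Product using (_×_; _,_)
  open import Function using (_∘_)
  open import Relation.Binary.PropositionalEquality hiding ([_])
  open import Relation.Nullary using (yes; no; Dec)
  open import Defs
  open FiniteSums
  open LinearCombinations
  open SymInstances
  open ZassenhausRecursion
  open CoproductMorphism
  open TensorProduct
  open GroupLike
  open import Algebra.Properties.Group QP.+-0-group using (∙-cancelˡ)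

  Δ-S : ∀ n → Δ (S (suc n)) ≃ convolve S (suc n)
  Δ-S n g = begin
      L g (Δ (S N))                 ≡⟨ L-Δ g (S N) ⟩
      1ℚ * L g (ΔS N ⊛⊗ TenAlg.one) + 0ℚ ≡⟨ trans (QP.+-identityʳ _) (QP.*-identityˡ _) ⟩
      L g (ΔS N ⊛⊗ TenAlg.one)      ≡⟨ TenAlg.one-r (ΔS N) g ⟩
      L g (ΔS N)                    ≡⟨ cong (L g) (sym as-singletons) ⟩
      L g (concat (map ([_] ∘ term) (upTo (suc N)))) ≡⟨ Σ-cong (suc N) ([_] ∘ term) (λ b → S b ⊗ S (N ∸ b)) (λ _ _ _ → refl) g ⟩
      L g (convolve S N) ∎
    where
    open ≡-Reasoning
    N : ℕ
    N = suc n
    term : ℕ → ℚ × (Word × Word)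
    term i = (1ℚ , (wrd i , wrd (N ∸ i)))
    as-singletons : concat (map ([_] ∘ term) (upTo (suc N))) ≡ ΔS N
    as-singletons = trans (cong concat (LP.map-∘ {g = [_]} {f = term} (upTo (suc N)))) (LP.concat-map-[_] (map term (upTo (suc N))))

  module _ (r : ℕ) .{{_ : NonZero r}} where
    open PredictedCoproduct r (ζ r)

    Δζ : ℕ → Sym⊗
    Δζ j = Δ (ζ r j)

    -- Δ applied to the defining relation: the degree-n part of
    -- (Σ_p Δζ_{pr}) ∏ e^{Δζ_i} is Δ S_n = Σ_b S_b ⊗ S_{n-b}, and by group-likeness
    -- this is also the degree-n part of the same series for the predicted family.
    RD-agree : ∀ n → TenAlg.RD r Δζ (suc n) ≃ TenAlg.RD r Δ-predicted (suc n)
    RD-agree n g = begin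
        L g (TenAlg.RD r Δζ N)               ≡⟨ sym (Δ-RD r (ζ r) N g) ⟩
        L g (Δ (SymAlg.RD r (ζ r) N))        ≡⟨ sym (Δ-cong {S N} {SymAlg.RD r (ζ r) N} (defining-relation r N) g) ⟩
        L g (Δ (S N))                        ≡⟨ Δ-S n g ⟩
        L g (convolve S N)                   ≡⟨ Σ-cong (suc N) (λ b → S b ⊗ S (N ∸ b)) (λ b → SymAlg.RD r (ζ r) b ⊗ SymAlg.RD r (ζ r) (N ∸ b))
                                                  (λ b _ → ⊗-cong {S b} {SymAlg.RD r (ζ r) b} {S (N ∸ b)} {SymAlg.RD r (ζ r) (N ∸ b)}
                                                           (defining-relation r b) (defining-relation r (N ∸ b))) g ⟩
        L g (convolve (SymAlg.RD r (ζ r)) N) ≡⟨ RD-grouplike N g ⟩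
        L g (TenAlg.RD r Δ-predicted N) ∎
      where
      open ≡-Reasoning
      N : ℕ
      N = suc n

    predicted-0 : Δ-predicted 0 ≃ TenAlg.one
    predicted-0 g = begin
        L g (Δ-predicted 0)  ≡⟨ predicted-divisible 0 (divides 0 refl) g ⟩
        L g (Δ-divisible 0)  ≡⟨ L-Σ g (suc (0 / r)) (λ i → ζ r (i ℕ.* r) ⊗ ζ r (0 ∸ i ℕ.* r)) ⟩
        ΣQ (suc (0 / r)) (λ i → L g (ζ r (i ℕ.* r) ⊗ ζ r (0 ∸ i ℕ.* r)))
          ≡⟨ cong (λ u → ΣQ (suc u) (λ i → L g (ζ r (i ℕ.* r) ⊗ ζ r (0 ∸ i ℕ.* r)))) (0/n≡0 r) ⟩
        ΣQ 1 (λ i → L g (ζ r (i ℕ.* r) ⊗ ζ r (0 ∸ i ℕ.* r)))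
          ≡⟨ trans (ΣQ-suc 0 _) (cong (L g (SymAlg.one ⊗ SymAlg.one) +_) (ΣQ-zero _)) ⟩
        L g (SymAlg.one ⊗ SymAlg.one) + 0ℚ ≡⟨ QP.+-identityʳ _ ⟩
        L g TenAlg.one ∎
      where open ≡-Reasoning

    -- Strong induction on n.  By extraction both series in RD-agree are
    -- "earlier entries" + top entry; the earlier entries agree by hypothesis.
    Δζ≃predicted : ∀ n → Δζ n ≃ Δ-predicted n
    Δζ≃predicted = <-rec (λ n → Δζ n ≃ Δ-predicted n) step
      where
      step : ∀ n → (∀ {k} → k < n → Δζ k ≃ Δ-predicted k) → Δζ n ≃ Δ-predicted n
      step zero    _  g = trans (Δ-one g) (sym (predicted-0 g))
      step (suc i) IH g = ∙-cancelˡ (L g (TenAlg.RD r (TenAlg.kill n Δ-predicted) n)) (L g (Δζ n)) (L g (Δ-predicted n)) (begin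
          L g (TenAlg.RD r (TenAlg.kill n Δ-predicted) n) + L g (Δζ n)
            ≡⟨ cong (_+ L g (Δζ n)) (sym (TenAlg.RD-cong r {TenAlg.kill n Δζ} {TenAlg.kill n Δ-predicted} n earlier-agree g)) ⟩
          L g (TenAlg.RD r (TenAlg.kill n Δζ) n) + L g (Δζ n)
            ≡⟨ sym (trans (TenAlg.Extraction.RD-extract r Δζ i Δ-one g) (L-++ g (TenAlg.RD r (TenAlg.kill n Δζ) n) (Δζ n))) ⟩
          L g (TenAlg.RD r Δζ n)
            ≡⟨ RD-agree i g ⟩
          L g (TenAlg.RD r Δ-predicted n)
            ≡⟨ trans (TenAlg.Extraction.RD-extract r Δ-predicted i predicted-0 g) (L-++ g (TenAlg.RD r (TenAlg.kill n Δ-predicted) n) (Δ-predicted n)) ⟩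
          L g (TenAlg.RD r (TenAlg.kill n Δ-predicted) n) + L g (Δ-predicted n) ∎)
        where
        open ≡-Reasoning
        n : ℕ
        n = suc i
        earlier-agree : ∀ j → j ≤ n → TenAlg.kill n Δζ j ≃ TenAlg.kill n Δ-predicted j
        earlier-agree j j≤n = by-cases (j ℕ.≟ n)
          where
          by-cases : Dec (j ≡ n) → TenAlg.kill n Δζ j ≃ TenAlg.kill n Δ-predicted j
          by-cases (yes refl) g = cong (L g) (trans (TenAlg.kill-eq n Δζ) (sym (TenAlg.kill-eq n Δ-predicted)))
          by-cases (no j≢n)   g = trans (sym (TenAlg.kill-ne n Δζ j j≢n g))
                                    (trans (IH (NP.≤∧≢⇒< j≤n j≢n) g) (TenAlg.kill-ne n Δ-predicted j j≢n g))

open CoproductOfZassenhaus using (Δζ≃predicted)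
open SymInstances using (≃⇒≈⊗)
open GroupLike using (module PredictedCoproduct)

open import Defs
open import Data.Nat using (ℕ; suc; _≤_; _*_; _∸_; _/_; NonZero)
open import Data.Nat.Divisibility using (_∣_)
open import Data.List using (concat; map; upTo)
open import Data.Product using (_×_; _,_)
open import Relation.Nullary using (¬_)
open import Relation.Binary.PropositionalEquality using (trans)

-- The theorem: Δζ_n equals its predicted value, read off in the two cases.
mainTheorem10 : (r : ℕ) .{{_ : NonZero r}} (n : ℕ) → 1 ≤ n →
    (¬ (r ∣ n) → Δ (ζ r n) ≈⊗ (one ⊗ ζ r n ⊕⊗ ζ r n ⊗ one))
    × (r ∣ n → Δ (ζ r n) ≈⊗ concat (map (λ i → ζ r (i * r) ⊗ ζ r (n ∸ i * r)) (upTo (suc (n / r)))))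
mainTheorem10 r n _ =
  (λ r∤n → ≃⇒≈⊗ {Δ (ζ r n)} {Δ-primitive n} (λ g → trans (Δζ≃predicted r n g) (predicted-primitive n r∤n g))) ,
  (λ r∣n → ≃⇒≈⊗ {Δ (ζ r n)} {Δ-divisible n} (λ g → trans (Δζ≃predicted r n g) (predicted-divisible n r∣n g)))
  where open PredictedCoproduct r (ζ r)
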